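{- Let $n\ge2$, $t>0$ and $\mathbf N=(t,0,\dots,0,-t)\in\mathbb Z^{n+1}$. The uniform average of the vertices of $\mathcal F_n(\mathbf N)$ is the flow $\mathbf f$ given by $f_{0,k}=t\,2^{ -k}$ for $1\le k\le n-1$, $f_{0,n}=t\,2^{ -(n-1)}$, $f_{i,k}=t\,2^{ -(k-i+1)}$ for $1\le i<k\le n-1$, and $f_{i,n}=t\,2^{ -(n-i)}$ for $1\le i\le n-1$ (and for this flow $\sum_{0\le r<i}(N_r-f_{ri})=t/2$ for $1\le i\le n-1$).
   Context: $\mathcal F_n(\mathbf N)$ is the polytope of real $\mathbf f=(f_{ij})_{0\le i<j\le n}$ with $f_{ij}\ge0$ and $\sum_{j>i}f_{ij}-\sum_{k<i}f_{ki}=N_i$ for all $i\in\{0,\dots,n\}$. The uniform average of the vertices is the arithmetic mean of its vertices.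
   Formalization: The polytope is taken over ℚ: flows have rational entries instead of real ones, and the convex combinations defining its vertices have rational coefficients. -}

module Defs where

open import Data.Nat as ℕ using (ℕ; zero; suc; _<ᵇ_; _≡ᵇ_)
open import Data.Integer using (ℤ; +_; -[1+_]; -_)
open import Data.Rational using (ℚ; 0ℚ; 1ℚ; ½; _+_; _-_; _*_; _/_; _≤_; _<_)
open import Data.Fin using (Fin; toℕ)
open import Data.List using (List; []; _∷_; foldr; map; length; allFin)
open import Data.List.Relation.Unary.Any using (Any)
open import Data.List.Relation.Unary.AllPairs using (AllPairs)
open import Data.Bool using (if_then_else_)
open import Data.Product using (_×_)
open import Relation.Binary.PropositionalEquality using (_≡_)
open import Relation.Nullary using (¬_)

-- A (real-valued, here rational) flow on the complete graph with vertices 0..n: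
-- only the entries f i j with i < j are meaningful; the others are ignored.
Flow : ℕ → Set
Flow n = Fin (suc n) → Fin (suc n) → ℚ

Σℚ : List ℚ → ℚ
Σℚ = foldr _+_ 0ℚ

_≋_ : ∀ {n} → Flow n → Flow n → Set
_≋_ {n} f g = ∀ (i j : Fin (suc n)) → toℕ i ℕ.< toℕ j → f i j ≡ g i j

outflow : ∀ {n} → Flow n → Fin (suc n) → ℚ
outflow {n} f i = Σℚ (map (λ j → if toℕ i <ᵇ toℕ j then f i j else 0ℚ) (allFin (suc n)))

inflow : ∀ {n} → Flow n → Fin (suc n) → ℚ
inflow {n} f i = Σℚ (map (λ k → if toℕ k <ᵇ toℕ i then f k i else 0ℚ) (allFin (suc n)))

InFlowPolytope : ∀ {n} → (Fin (suc n) → ℤ) → Flow n → Set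
InFlowPolytope {n} N f =
  (∀ (i j : Fin (suc n)) → toℕ i ℕ.< toℕ j → 0ℚ ≤ f i j)
  × (∀ (i : Fin (suc n)) → outflow f i - inflow f i ≡ N i / 1)

convComb : ∀ {n} → ℚ → Flow n → Flow n → Flow n
convComb l g h i j = l * g i j + (1ℚ - l) * h i j

IsVertex : ∀ {n} → (Fin (suc n) → ℤ) → Flow n → Set
IsVertex {n} N f =
  InFlowPolytope N f
  × (∀ (g h : Flow n) (l : ℚ) → InFlowPolytope N g → InFlowPolytope N h →
       0ℚ < l → l < 1ℚ → f ≋ convComb l g h → (f ≋ g × f ≋ h))

sumFlows : ∀ {n} → List (Flow n) → Flow n
sumFlows vs i j = Σℚ (map (λ v → v i j) vs)

average : ∀ {n} → List (Flow n) → Flow n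
average [] i j = 0ℚ
average (v ∷ vs) i j = ((+ 1) / suc (length vs)) * sumFlows (v ∷ vs) i j

netN : (n t : ℕ) → Fin (suc n) → ℤ
netN n t i = if toℕ i ≡ᵇ 0 then + t else (if toℕ i ≡ᵇ n then - (+ t) else + 0)

half^ : ℕ → ℚ
half^ zero = 1ℚ
half^ (suc m) = ½ * half^ m

targetFlow : (n t : ℕ) → Flow n
targetFlow n t i k =
  if toℕ i <ᵇ toℕ k
  then (if toℕ i ≡ᵇ 0
        then (if toℕ k ≡ᵇ n then tq * half^ (n ℕ.∸ 1) else tq * half^ (toℕ k))
        else (if toℕ k ≡ᵇ n then tq * half^ (n ℕ.∸ toℕ i)
              else tq * half^ (suc (toℕ k ℕ.∸ toℕ i))))
  else 0ℚ
  where tq = (+ t) / 1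

{-# OPTIONS --safe #-}
-- Write N = τ(e₀ − eₙ). For a path P from 0 to n in the complete acyclic graph on 0, …, n, the flow
-- τ·1_P is the only point of the polytope vanishing off P, so it is a vertex. Conversely every point
-- F of the polytope satisfies δ·τ·1_P ≤ F for some path P and some δ ∈ (0, 1]: merge the vertices
-- n−1 and n, find such a path by induction, and send its last edge along whichever of the two merged
-- edges carries at least half of its flow. Then F ± δ(τ·1_P − F) lie in the polytope, so a vertex F
-- equals τ·1_P. A path is determined by the set of inner vertices it visits, and the edge i → k is
-- used exactly by the paths visiting i and k and skipping everything in between, a fraction
-- 2^−(k−i+1) of them (fewer constraints when i = 0 or k = n); this gives the average. The last claim
-- is a geometric sum.

module Submission where

open import Defs
open import Data.Nat as ℕ using (ℕ; zero; suc; z≤n; s≤s; _<ᵇ_; _≡ᵇ_; _^_; _∸_)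
import Data.Nat.Properties as ℕP
open import Data.Integer as ℤ using (+_)
import Data.Integer.Properties as ℤP
open import Data.Rational as ℚ using (ℚ; 0ℚ; 1ℚ; ½; _+_; _-_; _*_; -_; _/_; _≤_; _<_; toℚᵘ)
import Data.Rational.Properties as ℚP
import Data.Rational.Unnormalised as ℚᵘ
import Data.Rational.Unnormalised.Properties as ℚᵘP
open import Data.Rational.Solver using (module +-*-Solver)
open import Data.Fin using (Fin; toℕ; fromℕ<)
import Data.Fin.Properties as FinP
open import Data.List using (List; []; _∷_; _++_; map; length; allFin; tabulate)
import Data.List.Properties as ListP
open import Data.List.Relation.Unary.All as All using (All; []; _∷_)
import Data.List.Relation.Unary.All.Properties as AllP
open import Data.List.Relation.Unary.Any as Any using (Any; here)
import Data.List.Relation.Unary.Any.Properties as AnyP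
open import Data.List.Relation.Unary.AllPairs as AllPairs using (AllPairs; []; _∷_)
import Data.List.Relation.Unary.AllPairs.Properties as AllPairsP
open import Data.Bool using (Bool; true; false; if_then_else_)
open import Data.Product using (_×_; _,_; proj₁; proj₂; ∃-syntax)
open import Data.Sum as Sum using (_⊎_; inj₁; inj₂)
open import Data.Empty using (⊥-elim)
open import Function using (_∘_)
open import Function.Bundles using (_⇔_; mk⇔)
open import Relation.Binary.PropositionalEquality
open import Relation.Nullary using (¬_; yes; no)
open import Algebra.Properties.Group ℚP.+-0-group using (x∙y⁻¹≈ε⇒x≈y)

open +-*-Solver

fromℕ : ℕ → ℚ
fromℕ k = + k / 1

toℚᵘ-fromℕ : ∀ k → toℚᵘ (fromℕ k) ℚᵘ.≃ ℚᵘ.mkℚᵘ (+ k) 0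
toℚᵘ-fromℕ k = ℚP.toℚᵘ-fromℚᵘ (ℚᵘ.mkℚᵘ (+ k) 0)

fromℕ-+ : ∀ a b → fromℕ (a ℕ.+ b) ≡ fromℕ a + fromℕ b
fromℕ-+ a b = ℚP.toℚᵘ-injective (begin
  toℚᵘ (fromℕ (a ℕ.+ b))                      ≈⟨ toℚᵘ-fromℕ (a ℕ.+ b) ⟩
  ℚᵘ.mkℚᵘ (+ (a ℕ.+ b)) 0                     ≈⟨ ℚᵘ.*≡* (cong (ℤ._* + 1) cross) ⟩
  ℚᵘ.mkℚᵘ (+ a) 0 ℚᵘ.+ ℚᵘ.mkℚᵘ (+ b) 0        ≈⟨ ℚᵘP.+-cong (toℚᵘ-fromℕ a) (toℚᵘ-fromℕ b) ⟨
  toℚᵘ (fromℕ a) ℚᵘ.+ toℚᵘ (fromℕ b)          ≈⟨ ℚP.toℚᵘ-homo-+ (fromℕ a) (fromℕ b) ⟨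
  toℚᵘ (fromℕ a + fromℕ b)                    ∎)
  where
  open ℚᵘP.≃-Reasoning
  cross : + (a ℕ.+ b) ≡ + a ℤ.* + 1 ℤ.+ + b ℤ.* + 1
  cross = trans (ℤP.pos-+ a b) (sym (cong₂ ℤ._+_ (ℤP.*-identityʳ (+ a)) (ℤP.*-identityʳ (+ b))))

1/suc*suc≡1 : ∀ k → (+ 1 / suc k) * fromℕ (suc k) ≡ 1ℚ
1/suc*suc≡1 k = ℚP.toℚᵘ-injective (begin
  toℚᵘ ((+ 1 / suc k) * fromℕ (suc k))          ≈⟨ ℚP.toℚᵘ-homo-* (+ 1 / suc k) (fromℕ (suc k)) ⟩
  toℚᵘ (+ 1 / suc k) ℚᵘ.* toℚᵘ (fromℕ (suc k))  ≈⟨ ℚᵘP.*-cong (ℚP.toℚᵘ-fromℚᵘ (ℚᵘ.mkℚᵘ (+ 1) k)) (toℚᵘ-fromℕ (suc k)) ⟩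
  ℚᵘ.1/ m ℚᵘ.* m                                ≈⟨ ℚᵘP.*-inverseˡ m ⟩
  ℚᵘ.1ℚᵘ                                        ∎)
  where open ℚᵘP.≃-Reasoning
        m = ℚᵘ.mkℚᵘ (+ suc k) 0

fromℕ*½ : ∀ t → fromℕ t * ½ ≡ + t / 2
fromℕ*½ t = ℚP.toℚᵘ-injective (begin
  toℚᵘ (fromℕ t * ½)                             ≈⟨ ℚP.toℚᵘ-homo-* (fromℕ t) ½ ⟩
  toℚᵘ (fromℕ t) ℚᵘ.* toℚᵘ ½                     ≈⟨ ℚᵘP.*-cong (toℚᵘ-fromℕ t) (ℚᵘP.≃-refl {toℚᵘ ½}) ⟩
  ℚᵘ.mkℚᵘ (+ t) 0 ℚᵘ.* ℚᵘ.mkℚᵘ (+ 1) 1           ≈⟨ ℚᵘ.*≡* (cong (ℤ._* + 2) (ℤP.*-identityʳ (+ t))) ⟩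
  ℚᵘ.mkℚᵘ (+ t) 1                                ≈⟨ ℚP.toℚᵘ-fromℚᵘ (ℚᵘ.mkℚᵘ (+ t) 1) ⟨
  toℚᵘ (+ t / 2)                                 ∎)
  where open ℚᵘP.≃-Reasoning

fromℕ-pos : ∀ t → 0ℚ < fromℕ (suc t)
fromℕ-pos t = ℚP.positive⁻¹ _ {{ℚP.normalize-pos (suc t) 1}}

neg/1≡-fromℕ : ∀ t → (ℤ.- (+ t)) / 1 ≡ - fromℕ t
neg/1≡-fromℕ zero    = refl
neg/1≡-fromℕ (suc t) = refl

fromℕ-double : ∀ k → fromℕ (2 ℕ.* k) ≡ fromℕ k + fromℕ k
fromℕ-double k = trans (fromℕ-+ k (k ℕ.+ 0)) (cong (λ x → fromℕ k + fromℕ x) (ℕP.+-identityʳ k))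

+-nonNeg : ∀ {a b} → 0ℚ ≤ a → 0ℚ ≤ b → 0ℚ ≤ a + b
+-nonNeg {a} {b} 0≤a 0≤b = subst (_≤ a + b) (ℚP.+-identityˡ 0ℚ) (ℚP.+-mono-≤ 0≤a 0≤b)

*-nonNeg : ∀ {a b} → 0ℚ ≤ a → 0ℚ ≤ b → 0ℚ ≤ a * b
*-nonNeg {a} {b} 0≤a 0≤b =
  ℚP.nonNegative⁻¹ _ {{ℚP.nonNeg*nonNeg⇒nonNeg a {{ℚ.nonNegative 0≤a}} b {{ℚ.nonNegative 0≤b}}}}

*-pos : ∀ {a b} → 0ℚ < a → 0ℚ < b → 0ℚ < a * b
*-pos {a} {b} 0<a 0<b =
  ℚP.positive⁻¹ _ {{ℚP.pos*pos⇒pos a {{ℚ.positive 0<a}} b {{ℚ.positive 0<b}}}}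

p≤q⇒0≤q-p : ∀ {p q} → p ≤ q → 0ℚ ≤ q - p
p≤q⇒0≤q-p {p} {q} p≤q = subst (_≤ q - p) (ℚP.+-inverseʳ p) (ℚP.+-monoˡ-≤ (- p) p≤q)

p<q⇒0<q-p : ∀ {p q} → p < q → 0ℚ < q - p
p<q⇒0<q-p {p} {q} p<q = subst (_< q - p) (ℚP.+-inverseʳ p) (ℚP.+-monoˡ-< (- p) p<q)

pos*p≡0⇒p≡0 : ∀ {c p} → 0ℚ < c → c * p ≡ 0ℚ → p ≡ 0ℚ
pos*p≡0⇒p≡0 {c} {p} 0<c cp≡0 = begin
  p                 ≡⟨ ℚP.*-identityˡ p ⟨
  1ℚ * p            ≡⟨ cong (_* p) (ℚP.*-inverseˡ c) ⟨
  (ℚ.1/ c * c) * p  ≡⟨ ℚP.*-assoc (ℚ.1/ c) c p ⟩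
  ℚ.1/ c * (c * p)  ≡⟨ cong (ℚ.1/ c *_) cp≡0 ⟩
  ℚ.1/ c * 0ℚ       ≡⟨ ℚP.*-zeroʳ (ℚ.1/ c) ⟩
  0ℚ                ∎
  where
  open ≡-Reasoning
  instance
    c≢0 : ℚ.NonZero c
    c≢0 = ℚP.pos⇒nonZero c {{ℚ.positive 0<c}}

pos-combination≡0⇒≡0 : ∀ {c d p q} → 0ℚ < c → 0ℚ < d → 0ℚ ≤ p → 0ℚ ≤ q →
                       c * p + d * q ≡ 0ℚ → p ≡ 0ℚ
pos-combination≡0⇒≡0 {c} {d} {p} {q} 0<c 0<d 0≤p 0≤q cp+dq≡0 =
  pos*p≡0⇒p≡0 0<c (ℚP.≤-antisym cp≤0 (*-nonNeg (ℚP.<⇒≤ 0<c) 0≤p))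
  where
  cp≤0 : c * p ≤ 0ℚ
  cp≤0 = subst₂ _≤_ (ℚP.+-identityʳ (c * p)) cp+dq≡0
           (ℚP.+-monoʳ-≤ (c * p) (*-nonNeg (ℚP.<⇒≤ 0<d) 0≤q))

p*½≤p : ∀ {p} → 0ℚ ≤ p → p * ½ ≤ p
p*½≤p {p} 0≤p = subst₂ _≤_ (ℚP.+-identityʳ (p * ½)) (solve 1 (λ p → p :* con ½ :+ p :* con ½ := p) refl p)
                  (ℚP.+-monoʳ-≤ (p * ½) (*-nonNeg 0≤p (ℚP.<⇒≤ (ℚP.positive⁻¹ ½))))

p≤p+q : ∀ p {q} → 0ℚ ≤ q → p ≤ p + q
p≤p+q p {q} 0≤q = subst (_≤ p + q) (ℚP.+-identityʳ p) (ℚP.+-monoʳ-≤ p 0≤q)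

half-of-sum : ∀ {s p q} → s ≤ p + q → ¬ (s * ½ ≤ q) → s * ½ ≤ p
half-of-sum {s} {p} {q} s≤p+q ½s≰q with s * ½ ℚP.≤? p
... | yes ½s≤p = ½s≤p
... | no  ½s≰p = ⊥-elim (ℚP.<-irrefl refl (ℚP.≤-<-trans s≤p+q
        (subst (p + q <_) (solve 1 (λ s → s :* con ½ :+ s :* con ½ := s) refl s)
          (ℚP.+-mono-< (ℚP.≰⇒> ½s≰p) (ℚP.≰⇒> ½s≰q)))))

sumBelow : ℕ → (ℕ → ℚ) → ℚ
sumBelow zero    G = 0ℚ
sumBelow (suc k) G = sumBelow k G + G k

sumBelow-cong : ∀ k {G H} → (∀ j → j ℕ.< k → G j ≡ H j) → sumBelow k G ≡ sumBelow k H
sumBelow-cong zero    G≡H = refl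
sumBelow-cong (suc k) G≡H = cong₂ _+_ (sumBelow-cong k (λ j j<k → G≡H j (ℕP.m≤n⇒m≤1+n j<k))) (G≡H k ℕP.≤-refl)

sumBelow-zero : ∀ k {G} → (∀ j → j ℕ.< k → G j ≡ 0ℚ) → sumBelow k G ≡ 0ℚ
sumBelow-zero zero    G≡0 = refl
sumBelow-zero (suc k) G≡0 =
  trans (cong₂ _+_ (sumBelow-zero k (λ j j<k → G≡0 j (ℕP.m≤n⇒m≤1+n j<k))) (G≡0 k ℕP.≤-refl)) (ℚP.+-identityˡ 0ℚ)

sumBelow-+ : ∀ k G H → sumBelow k (λ j → G j + H j) ≡ sumBelow k G + sumBelow k H
sumBelow-+ zero    G H = refl
sumBelow-+ (suc k) G H = trans (cong (_+ (G k + H k)) (sumBelow-+ k G H))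
  (solve 4 (λ a b x y → (a :+ b) :+ (x :+ y) := (a :+ x) :+ (b :+ y)) refl (sumBelow k G) (sumBelow k H) (G k) (H k))

sumBelow-* : ∀ k c G → sumBelow k (λ j → c * G j) ≡ c * sumBelow k G
sumBelow-* zero    c G = sym (ℚP.*-zeroʳ c)
sumBelow-* (suc k) c G = trans (cong (_+ c * G k) (sumBelow-* k c G)) (sym (ℚP.*-distribˡ-+ c (sumBelow k G) (G k)))

sumBelow-suc : ∀ k G → sumBelow (suc k) G ≡ G 0 + sumBelow k (G ∘ suc)
sumBelow-suc zero    G = ℚP.+-comm 0ℚ (G 0)
sumBelow-suc (suc k) G = trans (cong (_+ G (suc k)) (sumBelow-suc k G)) (ℚP.+-assoc (G 0) _ (G (suc k)))

sumBelow-nonNeg : ∀ k {G} → (∀ j → j ℕ.< k → 0ℚ ≤ G j) → 0ℚ ≤ sumBelow k G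
sumBelow-nonNeg zero    0≤G = ℚP.≤-refl
sumBelow-nonNeg (suc k) 0≤G = +-nonNeg (sumBelow-nonNeg k (λ j j<k → 0≤G j (ℕP.m≤n⇒m≤1+n j<k))) (0≤G k ℕP.≤-refl)

term≤sumBelow : ∀ k {G} j → j ℕ.< k → (∀ j → j ℕ.< k → 0ℚ ≤ G j) → G j ≤ sumBelow k G
term≤sumBelow (suc k) {G} j j<1+k 0≤G with j ℕ.≟ k
... | yes refl = subst (_≤ sumBelow k G + G j) (ℚP.+-identityˡ (G j))
                   (ℚP.+-monoˡ-≤ (G j) (sumBelow-nonNeg k (λ i i<k → 0≤G i (ℕP.m≤n⇒m≤1+n i<k))))
... | no  j≢k  = ℚP.≤-trans (term≤sumBelow k j (ℕP.≤∧≢⇒< (ℕP.≤-pred j<1+k) j≢k) (λ i i<k → 0≤G i (ℕP.m≤n⇒m≤1+n i<k)))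
                           (p≤p+q (sumBelow k G) (0≤G k ℕP.≤-refl))

sumBelow-trunc : ∀ {I} k {G} → I ℕ.≤ k → (∀ r → I ℕ.≤ r → r ℕ.< k → G r ≡ 0ℚ) → sumBelow k G ≡ sumBelow I G
sumBelow-trunc k I≤k G≡0 with ℕP.m≤n⇒m<n∨m≡n I≤k
... | inj₂ refl = refl
sumBelow-trunc (suc k) I≤k G≡0 | inj₁ I<1+k =
  trans (cong₂ _+_ (sumBelow-trunc k (ℕP.≤-pred I<1+k) (λ r I≤r r<k → G≡0 r I≤r (ℕP.m≤n⇒m≤1+n r<k)))
                   (G≡0 k (ℕP.≤-pred I<1+k) ℕP.≤-refl))
        (ℚP.+-identityʳ _)

Σℚ-allFin : ∀ k G → Σℚ (map (G ∘ toℕ) (allFin k)) ≡ sumBelow k G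
Σℚ-allFin k G = trans (cong Σℚ (ListP.map-tabulate {n = k} (λ x → x) (G ∘ toℕ))) (Σℚ-tabulate k G)
  where
  Σℚ-tabulate : ∀ k G → Σℚ (tabulate {n = k} (G ∘ toℕ)) ≡ sumBelow k G
  Σℚ-tabulate zero    G = refl
  Σℚ-tabulate (suc k) G = trans (cong (_+_ (G 0)) (Σℚ-tabulate k (G ∘ suc))) (sym (sumBelow-suc k G))

Σℚ-++ : ∀ xs ys → Σℚ (xs ++ ys) ≡ Σℚ xs + Σℚ ys
Σℚ-++ []       ys = sym (ℚP.+-identityˡ (Σℚ ys))
Σℚ-++ (x ∷ xs) ys = trans (cong (_+_ x) (Σℚ-++ xs ys)) (sym (ℚP.+-assoc x (Σℚ xs) (Σℚ ys)))

Σℚ-map-cong : ∀ {A : Set} {f g : A → ℚ} xs → (∀ x → f x ≡ g x) → Σℚ (map f xs) ≡ Σℚ (map g xs)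
Σℚ-map-cong xs f≗g = cong Σℚ (ListP.map-cong f≗g xs)

Σℚ-map-const : ∀ {A : Set} (xs : List A) c → Σℚ (map (λ _ → c) xs) ≡ fromℕ (length xs) * c
Σℚ-map-const []       c = sym (ℚP.*-zeroˡ c)
Σℚ-map-const (x ∷ xs) c = begin
  c + Σℚ (map (λ _ → c) xs)     ≡⟨ cong (_+_ c) (Σℚ-map-const xs c) ⟩
  c + fromℕ (length xs) * c     ≡⟨ solve 2 (λ c l → c :+ l :* c := (con 1ℚ :+ l) :* c) refl c (fromℕ (length xs)) ⟩
  (1ℚ + fromℕ (length xs)) * c  ≡⟨ cong (_* c) (fromℕ-+ 1 (length xs)) ⟨
  fromℕ (suc (length xs)) * c   ∎
  where open ≡-Reasoning

Σℚ-map-zero : ∀ {A : Set} {f : A → ℚ} xs → (∀ x → f x ≡ 0ℚ) → Σℚ (map f xs) ≡ 0ℚ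
Σℚ-map-zero xs f≡0 = trans (Σℚ-map-cong xs f≡0) (trans (Σℚ-map-const xs 0ℚ) (ℚP.*-zeroʳ (fromℕ (length xs))))

Σℚ-map-++-map : ∀ {A : Set} (h : A → ℚ) f g (xs : List A) →
                Σℚ (map h (map f xs ++ map g xs)) ≡ Σℚ (map (h ∘ f) xs) + Σℚ (map (h ∘ g) xs)
Σℚ-map-++-map h f g xs = begin
  Σℚ (map h (map f xs ++ map g xs))               ≡⟨ cong Σℚ (ListP.map-++ h (map f xs) (map g xs)) ⟩
  Σℚ (map h (map f xs) ++ map h (map g xs))       ≡⟨ Σℚ-++ (map h (map f xs)) (map h (map g xs)) ⟩
  Σℚ (map h (map f xs)) + Σℚ (map h (map g xs))   ≡⟨ cong₂ _+_ (cong Σℚ (ListP.map-∘ xs)) (cong Σℚ (ListP.map-∘ xs)) ⟨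
  Σℚ (map (h ∘ f) xs) + Σℚ (map (h ∘ g) xs)       ∎
  where open ≡-Reasoning

sumBelow-half^ : ∀ a → sumBelow a (λ r → half^ (suc (a ∸ r))) + half^ (suc a) ≡ ½
sumBelow-half^ zero    = refl
sumBelow-half^ (suc a) = begin
  sumBelow (suc a) (λ r → half^ (suc (suc a ∸ r))) + half^ (suc (suc a))
    ≡⟨ cong (_+ half^ (suc (suc a))) (sumBelow-suc a (λ r → half^ (suc (suc a ∸ r)))) ⟩
  (½ * h + S) + ½ * h
    ≡⟨ solve 2 (λ h S → (con ½ :* h :+ S) :+ con ½ :* h := S :+ h) refl h S ⟩
  S + h
    ≡⟨ sumBelow-half^ a ⟩
  ½ ∎
  where
  open ≡-Reasoning
  h = half^ (suc a)
  S = sumBelow a (λ r → half^ (suc (a ∸ r)))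

<ᵇ-true : ∀ {m n} → m ℕ.< n → (m <ᵇ n) ≡ true
<ᵇ-true {zero}  {suc n} _         = refl
<ᵇ-true {suc m} {suc n} (s≤s m<n) = <ᵇ-true m<n

<ᵇ-false : ∀ {m n} → n ℕ.≤ m → (m <ᵇ n) ≡ false
<ᵇ-false {m}     {zero}  _         = refl
<ᵇ-false {suc m} {suc n} (s≤s n≤m) = <ᵇ-false n≤m

≡ᵇ-refl : ∀ n → (n ≡ᵇ n) ≡ true
≡ᵇ-refl zero    = refl
≡ᵇ-refl (suc n) = ≡ᵇ-refl n

≡ᵇ-false : ∀ {m n} → m ≢ n → (m ≡ᵇ n) ≡ false
≡ᵇ-false {zero}  {zero}  m≢n = ⊥-elim (m≢n refl)
≡ᵇ-false {zero}  {suc n} _   = refl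
≡ᵇ-false {suc m} {zero}  _   = refl
≡ᵇ-false {suc m} {suc n} m≢n = ≡ᵇ-false (m≢n ∘ cong suc)

when : Bool → ℚ → ℚ
when b x = if b then x else 0ℚ

when-< : ∀ {m n} x → m ℕ.< n → when (m <ᵇ n) x ≡ x
when-< x m<n rewrite <ᵇ-true m<n = refl

when-≥ : ∀ {m n} x → n ℕ.≤ m → when (m <ᵇ n) x ≡ 0ℚ
when-≥ x n≤m rewrite <ᵇ-false n≤m = refl

when-<-cong : ∀ {m n x y} → (m ℕ.< n → x ≡ y) → when (m <ᵇ n) x ≡ when (m <ᵇ n) y
when-<-cong {m} {n} {x} {y} x≡y with m ℕ.<? n
... | yes m<n = trans (when-< x m<n) (trans (x≡y m<n) (sym (when-< y m<n)))
... | no  m≮n = trans (when-≥ x (ℕP.≮⇒≥ m≮n)) (sym (when-≥ y (ℕP.≮⇒≥ m≮n)))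

when-+ : ∀ b x y → when b (x + y) ≡ when b x + when b y
when-+ true  x y = refl
when-+ false x y = sym (ℚP.+-identityˡ 0ℚ)

when-* : ∀ b c x → when b (c * x) ≡ c * when b x
when-* true  c x = refl
when-* false c x = sym (ℚP.*-zeroʳ c)

-- A flow on the vertices 0, …, n for any n; only the entries i < j ≤ n are ever used.
Flowℕ : Set
Flowℕ = ℕ → ℕ → ℚ

outflowℕ : ℕ → Flowℕ → ℕ → ℚ
outflowℕ n F i = sumBelow (suc n) (λ j → when (i <ᵇ j) (F i j))

inflowℕ : ℕ → Flowℕ → ℕ → ℚ
inflowℕ n F i = sumBelow (suc n) (λ k → when (k <ᵇ i) (F k i))

EdgewiseEq : ℕ → Flowℕ → Flowℕ → Set
EdgewiseEq n F G = ∀ i j → i ℕ.< j → j ℕ.≤ n → F i j ≡ G i j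

SupportedOn : ℕ → Flowℕ → Flowℕ → Set
SupportedOn n G F = ∀ i j → i ℕ.< j → j ℕ.≤ n → F i j ≡ 0ℚ → G i j ≡ 0ℚ

outflowℕ-cong : ∀ n F G i → (∀ j → i ℕ.< j → j ℕ.≤ n → F i j ≡ G i j) → outflowℕ n F i ≡ outflowℕ n G i
outflowℕ-cong n F G i F≡G = sumBelow-cong (suc n) (λ j j≤n → when-<-cong (λ i<j → F≡G j i<j (ℕP.≤-pred j≤n)))

inflowℕ-cong : ∀ n F G i → (∀ k → k ℕ.< i → F k i ≡ G k i) → inflowℕ n F i ≡ inflowℕ n G i
inflowℕ-cong n F G i F≡G = sumBelow-cong (suc n) (λ k _ → when-<-cong (F≡G k))

outflowℕ-last : ∀ n F → outflowℕ n F n ≡ 0ℚ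
outflowℕ-last n F = sumBelow-zero (suc n) (λ j j≤n → when-≥ (F n j) (ℕP.≤-pred j≤n))

outflowℕ-penultimate : ∀ n F → outflowℕ (suc n) F n ≡ F n (suc n)
outflowℕ-penultimate n F =
  trans (cong₂ _+_ (outflowℕ-last n F) (when-< (F n (suc n)) (ℕP.n<1+n n))) (ℚP.+-identityˡ _)

inflowℕ-suc : ∀ n F {i} → i ℕ.≤ suc n → inflowℕ (suc n) F i ≡ inflowℕ n F i
inflowℕ-suc n F {i} i≤1+n =
  trans (cong (_+_ (inflowℕ n F i)) (when-≥ (F (suc n) i) i≤1+n)) (ℚP.+-identityʳ _)

by-last-column : ∀ {n} (P : ℕ → ℕ → Set) → (∀ i j → i ℕ.< j → j ℕ.< n → P i j) → (∀ i → i ℕ.< n → P i n) →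
                 ∀ i j → i ℕ.< j → j ℕ.≤ n → P i j
by-last-column {n} P below last i j i<j j≤n with j ℕ.≟ n
... | yes refl = last i i<j
... | no  j≢n  = below i j i<j (ℕP.≤∧≢⇒< j≤n j≢n)

by-last-two-columns : ∀ {n} (P : ℕ → ℕ → Set) → (∀ i j → i ℕ.< j → j ℕ.< n → P i j) → (∀ i → i ℕ.< n → P i n) →
                      (∀ i → i ℕ.< suc n → P i (suc n)) → ∀ i j → i ℕ.< j → j ℕ.≤ suc n → P i j
by-last-two-columns P below at-n at-top =
  by-last-column P (λ i j i<j j<1+n → by-last-column P below at-n i j i<j (ℕP.≤-pred j<1+n)) at-top

ScaledBelow : ℕ → ℚ → Flowℕ → Flowℕ → Set
ScaledBelow n δ p F = ∀ i j → i ℕ.< j → j ℕ.≤ n → δ * p i j ≤ F i j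

Dominates : ℕ → Flowℕ → Flowℕ → Set
Dominates n F p = ∃[ δ ] 0ℚ < δ × δ ≤ 1ℚ × ScaledBelow n δ p F

linComb : ℚ → Flowℕ → ℚ → Flowℕ → Flowℕ
linComb a F b G i j = a * F i j + b * G i j

sumBelow-when-linComb : ∀ k (B : ℕ → Bool) (a : ℚ) (G : ℕ → ℚ) (b : ℚ) (H : ℕ → ℚ) →
  sumBelow k (λ j → when (B j) (a * G j + b * H j))
    ≡ a * sumBelow k (λ j → when (B j) (G j)) + b * sumBelow k (λ j → when (B j) (H j))
sumBelow-when-linComb k B a G b H = begin
  sumBelow k (λ j → when (B j) (a * G j + b * H j))
    ≡⟨ sumBelow-cong k (λ j _ → trans (when-+ (B j) (a * G j) (b * H j))
                                      (cong₂ _+_ (when-* (B j) a (G j)) (when-* (B j) b (H j)))) ⟩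
  sumBelow k (λ j → a * when (B j) (G j) + b * when (B j) (H j))
    ≡⟨ sumBelow-+ k (λ j → a * when (B j) (G j)) (λ j → b * when (B j) (H j)) ⟩
  sumBelow k (λ j → a * when (B j) (G j)) + sumBelow k (λ j → b * when (B j) (H j))
    ≡⟨ cong₂ _+_ (sumBelow-* k a (λ j → when (B j) (G j))) (sumBelow-* k b (λ j → when (B j) (H j))) ⟩
  a * sumBelow k (λ j → when (B j) (G j)) + b * sumBelow k (λ j → when (B j) (H j)) ∎
  where open ≡-Reasoning

contract : ℕ → Flowℕ → Flowℕ
contract n F i j = if j ≡ᵇ n then F i n + F i (suc n) else F i j

contract-≢ : ∀ n F i {j} → j ≢ n → contract n F i j ≡ F i j
contract-≢ n F i j≢n rewrite ≡ᵇ-false j≢n = refl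

contract-last : ∀ n F i → contract n F i n ≡ F i n + F i (suc n)
contract-last n F i rewrite ≡ᵇ-refl n = refl

outflowℕ-contract : ∀ n F {i} → i ℕ.< n → outflowℕ n (contract n F) i ≡ outflowℕ (suc n) F i
outflowℕ-contract n F {i} i<n = begin
  outflowℕ n (contract n F) i
    ≡⟨ cong₂ _+_ (sumBelow-cong n (λ j j<n → cong (when (i <ᵇ j)) (contract-≢ n F i (ℕP.<⇒≢ j<n))))
                 (trans (when-< _ i<n) (contract-last n F i)) ⟩
  S + (F i n + F i (suc n))
    ≡⟨ ℚP.+-assoc S (F i n) (F i (suc n)) ⟨
  S + F i n + F i (suc n)
    ≡⟨ cong₂ (λ x y → S + x + y) (when-< (F i n) i<n) (when-< (F i (suc n)) (ℕP.m<n⇒m<1+n i<n)) ⟨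
  outflowℕ (suc n) F i ∎
  where
  open ≡-Reasoning
  S = sumBelow n (λ j → when (i <ᵇ j) (F i j))

inflowℕ-contract : ∀ n F {i} → i ℕ.< n → inflowℕ n (contract n F) i ≡ inflowℕ (suc n) F i
inflowℕ-contract n F {i} i<n =
  trans (inflowℕ-cong n (contract n F) F i (λ k _ → contract-≢ n F k (ℕP.<⇒≢ i<n))) (sym (inflowℕ-suc n F (ℕP.m<n⇒m≤1+n i<n)))

inflowℕ-contract-last : ∀ n F → inflowℕ n (contract n F) n ≡ inflowℕ n F n + sumBelow n (λ k → F k (suc n))
inflowℕ-contract-last n F = begin
  inflowℕ n (contract n F) n
    ≡⟨ sumBelow-cong (suc n) (λ k _ → trans (when-<-cong {k} {n} (λ _ → contract-last n F k)) (when-+ (k <ᵇ n) _ _)) ⟩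
  sumBelow (suc n) (λ k → when (k <ᵇ n) (F k n) + when (k <ᵇ n) (F k (suc n)))
    ≡⟨ sumBelow-+ (suc n) (λ k → when (k <ᵇ n) (F k n)) (λ k → when (k <ᵇ n) (F k (suc n))) ⟩
  inflowℕ n F n + (sumBelow n (λ k → when (k <ᵇ n) (F k (suc n))) + when (n <ᵇ n) (F n (suc n)))
    ≡⟨ cong (_+_ (inflowℕ n F n)) (trans (cong₂ _+_ (sumBelow-cong n (λ k k<n → when-< (F k (suc n)) k<n))
                                                    (when-≥ (F n (suc n)) (ℕP.≤-refl {n})))
                                         (ℚP.+-identityʳ _)) ⟩
  inflowℕ n F n + sumBelow n (λ k → F k (suc n)) ∎
  where open ≡-Reasoning

inflowℕ-self : ∀ n F → inflowℕ n F n ≡ sumBelow n (λ k → F k n)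
inflowℕ-self n F =
  trans (cong₂ _+_ (sumBelow-cong n (λ k k<n → when-< (F k n) k<n)) (when-≥ (F n n) (ℕP.≤-refl {n})))
        (ℚP.+-identityʳ _)

-- The flow polytope of N = (τ, 0, …, 0, −τ)

module _ (τ : ℚ) where

  net : ℕ → ℕ → ℚ
  net n i = if i ≡ᵇ 0 then τ else (if i ≡ᵇ n then - τ else 0ℚ)

  net-last : ∀ n → 1 ℕ.≤ n → net n n ≡ - τ
  net-last (suc n) _ rewrite ≡ᵇ-refl n = refl

  net-suc : ∀ {n i} → i ℕ.< n → net (suc n) i ≡ net n i
  net-suc i<n rewrite ≡ᵇ-false (ℕP.<⇒≢ (ℕP.m<n⇒m<1+n i<n)) | ≡ᵇ-false (ℕP.<⇒≢ i<n) = refl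

  net-suc-last : ∀ {n} → 1 ℕ.≤ n → net (suc n) n ≡ 0ℚ
  net-suc-last {suc n} _ rewrite ≡ᵇ-false (ℕP.<⇒≢ (ℕP.n<1+n n)) = refl

  record InPolytope (n : ℕ) (F : Flowℕ) : Set where
    field
      nonNeg   : ∀ i j → i ℕ.< j → j ℕ.≤ n → 0ℚ ≤ F i j
      conserve : ∀ i → i ℕ.≤ n → outflowℕ n F i - inflowℕ n F i ≡ net n i

  open InPolytope

  inflowℕ-sink : ∀ {n F} → 1 ℕ.≤ n → InPolytope n F → inflowℕ n F n ≡ τ
  inflowℕ-sink {n} {F} 1≤n F∈ = ℚP.neg-injective (begin
    - inflowℕ n F n                        ≡⟨ ℚP.+-identityˡ _ ⟨
    0ℚ - inflowℕ n F n                     ≡⟨ cong (_- inflowℕ n F n) (outflowℕ-last n F) ⟨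
    outflowℕ n F n - inflowℕ n F n         ≡⟨ conserve F∈ n ℕP.≤-refl ⟩
    net n n                                ≡⟨ net-last n 1≤n ⟩
    - τ                                    ∎)
    where open ≡-Reasoning

  penultimate-balance : ∀ {n F} → 1 ℕ.≤ n → InPolytope (suc n) F → F n (suc n) ≡ inflowℕ n F n
  penultimate-balance {n} {F} 1≤n F∈ = x∙y⁻¹≈ε⇒x≈y _ _ (begin
    F n (suc n) - inflowℕ n F n                   ≡⟨ cong₂ _-_ (outflowℕ-penultimate n F) (inflowℕ-suc n F (ℕP.n≤1+n n)) ⟨
    outflowℕ (suc n) F n - inflowℕ (suc n) F n    ≡⟨ conserve F∈ n (ℕP.n≤1+n n) ⟩
    net (suc n) n                                 ≡⟨ net-suc-last 1≤n ⟩
    0ℚ                                            ∎)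
    where open ≡-Reasoning

  -- All of n's inflow is forwarded along n → n+1, so the merged vertex receives the inflow τ of n+1.
  contract-∈ : ∀ {n F} → 1 ℕ.≤ n → InPolytope (suc n) F → InPolytope n (contract n F)
  contract-∈ {n} {F} 1≤n F∈ = record { nonNeg = by-last-column _ nonNeg-below nonNeg-n ; conserve = conserve′ }
    where
    nonNeg-below : ∀ i j → i ℕ.< j → j ℕ.< n → 0ℚ ≤ contract n F i j
    nonNeg-below i j i<j j<n =
      subst (0ℚ ≤_) (sym (contract-≢ n F i (ℕP.<⇒≢ j<n))) (nonNeg F∈ i j i<j (ℕP.m<n⇒m≤1+n j<n))
    nonNeg-n : ∀ i → i ℕ.< n → 0ℚ ≤ contract n F i n
    nonNeg-n i i<n = subst (0ℚ ≤_) (sym (contract-last n F i))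
                       (+-nonNeg (nonNeg F∈ i n i<n (ℕP.n≤1+n n)) (nonNeg F∈ i (suc n) (ℕP.m<n⇒m<1+n i<n) ℕP.≤-refl))
    conserve′ : ∀ i → i ℕ.≤ n → outflowℕ n (contract n F) i - inflowℕ n (contract n F) i ≡ net n i
    conserve′ i i≤n with ℕP.m≤n⇒m<n∨m≡n i≤n
    ... | inj₁ i<n = begin
      outflowℕ n (contract n F) i - inflowℕ n (contract n F) i
        ≡⟨ cong₂ _-_ (outflowℕ-contract n F i<n) (inflowℕ-contract n F i<n) ⟩
      outflowℕ (suc n) F i - inflowℕ (suc n) F i
        ≡⟨ conserve F∈ i (ℕP.m≤n⇒m≤1+n i≤n) ⟩
      net (suc n) i
        ≡⟨ net-suc i<n ⟩
      net n i ∎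
      where open ≡-Reasoning
    ... | inj₂ refl = begin
      outflowℕ n (contract n F) n - inflowℕ n (contract n F) n
        ≡⟨ cong₂ _-_ (outflowℕ-last n (contract n F)) inflow-n ⟩
      0ℚ - τ
        ≡⟨ trans (ℚP.+-identityˡ (- τ)) (sym (net-last n 1≤n)) ⟩
      net n n ∎
      where
      open ≡-Reasoning
      S = sumBelow n (λ k → F k (suc n))
      inflow-n : inflowℕ n (contract n F) n ≡ τ
      inflow-n = begin
        inflowℕ n (contract n F) n   ≡⟨ inflowℕ-contract-last n F ⟩
        inflowℕ n F n + S            ≡⟨ cong (_+ S) (penultimate-balance 1≤n F∈) ⟨
        F n (suc n) + S              ≡⟨ ℚP.+-comm (F n (suc n)) S ⟩
        S + F n (suc n)              ≡⟨ inflowℕ-self (suc n) F ⟨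
        inflowℕ (suc n) F (suc n)    ≡⟨ inflowℕ-sink (s≤s z≤n) F∈ ⟩
        τ                            ∎

  linComb-∈ : ∀ {n F G} a b → a + b ≡ 1ℚ → (∀ i j → i ℕ.< j → j ℕ.≤ n → 0ℚ ≤ linComb a F b G i j) →
              InPolytope n F → InPolytope n G → InPolytope n (linComb a F b G)
  linComb-∈ {n} {F} {G} a b a+b≡1 nonNeg′ F∈ G∈ = record { nonNeg = nonNeg′ ; conserve = conserve′ }
    where
    conserve′ : ∀ i → i ℕ.≤ n → outflowℕ n (linComb a F b G) i - inflowℕ n (linComb a F b G) i ≡ net n i
    conserve′ i i≤n = begin
      outflowℕ n (linComb a F b G) i - inflowℕ n (linComb a F b G) i
        ≡⟨ cong₂ _-_ (sumBelow-when-linComb (suc n) (i <ᵇ_) a (F i) b (G i))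
                     (sumBelow-when-linComb (suc n) (_<ᵇ i) a (λ k → F k i) b (λ k → G k i)) ⟩
      (a * OF + b * OG) - (a * IF + b * IG)
        ≡⟨ solve 6 (λ a b OF OG IF IG → (a :* OF :+ b :* OG) :- (a :* IF :+ b :* IG)
                                        := a :* (OF :- IF) :+ b :* (OG :- IG)) refl a b OF OG IF IG ⟩
      a * (OF - IF) + b * (OG - IG)
        ≡⟨ cong₂ (λ x y → a * x + b * y) (conserve F∈ i i≤n) (conserve G∈ i i≤n) ⟩
      a * net n i + b * net n i
        ≡⟨ ℚP.*-distribʳ-+ (net n i) a b ⟨
      (a + b) * net n i
        ≡⟨ trans (cong (_* net n i) a+b≡1) (ℚP.*-identityˡ (net n i)) ⟩
      net n i ∎
      where
      open ≡-Reasoning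
      OF = outflowℕ n F i
      OG = outflowℕ n G i
      IF = inflowℕ n F i
      IG = inflowℕ n G i

  perturbations-∈ : ∀ {n F p δ} → InPolytope n F → InPolytope n p → 0ℚ ≤ δ → δ ≤ 1ℚ → ScaledBelow n δ p F →
                    InPolytope n (linComb (1ℚ - δ) F δ p) × InPolytope n (linComb (1ℚ + δ) F (- δ) p)
  perturbations-∈ {n} {F} {p} {δ} F∈ p∈ 0≤δ δ≤1 δp≤F =
    linComb-∈ (1ℚ - δ) δ (solve 1 (λ d → (con 1ℚ :- d) :+ d := con 1ℚ) refl δ) toward F∈ p∈ ,
    linComb-∈ (1ℚ + δ) (- δ) (solve 1 (λ d → (con 1ℚ :+ d) :+ (:- d) := con 1ℚ) refl δ) away F∈ p∈
    where
    toward : ∀ i j → i ℕ.< j → j ℕ.≤ n → 0ℚ ≤ (1ℚ - δ) * F i j + δ * p i j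
    toward i j i<j j≤n = +-nonNeg (*-nonNeg (p≤q⇒0≤q-p δ≤1) (nonNeg F∈ i j i<j j≤n)) (*-nonNeg 0≤δ (nonNeg p∈ i j i<j j≤n))
    away : ∀ i j → i ℕ.< j → j ℕ.≤ n → 0ℚ ≤ (1ℚ + δ) * F i j + (- δ) * p i j
    away i j i<j j≤n =
      subst (0ℚ ≤_) (solve 3 (λ F d p → (F :- d :* p) :+ d :* F := (con 1ℚ :+ d) :* F :+ (:- d) :* p) refl (F i j) δ (p i j))
        (+-nonNeg (p≤q⇒0≤q-p (δp≤F i j i<j j≤n)) (*-nonNeg 0≤δ (nonNeg F∈ i j i<j j≤n)))

  single-edge≡τ : ∀ {F} → InPolytope 1 F → F 0 1 ≡ τ
  single-edge≡τ {F} F∈ = trans (solve 1 (λ x → x := con 0ℚ :+ con 0ℚ :+ x :- (con 0ℚ :+ con 0ℚ :+ con 0ℚ)) refl (F 0 1))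
                             (conserve F∈ 0 z≤n)

-- Path flows

module _ (τ : ℚ) where
  open InPolytope

  edge01 : Flowℕ
  edge01 zero (suc zero) = τ
  edge01 _    _          = 0ℚ

  -- A path from 0 to n+1 either is a path from 0 to n followed by n → n+1 (extend), or arises from
  -- a path from 0 to n by redirecting its last edge into n+1 (reroute).
  extend : ℕ → Flowℕ → Flowℕ
  extend n p i j = if j ≡ᵇ suc n then (if i ≡ᵇ n then τ else 0ℚ) else p i j

  reroute : ℕ → Flowℕ → Flowℕ
  reroute n p i j = if j ≡ᵇ suc n then when (i <ᵇ n) (p i n) else (if j ≡ᵇ n then 0ℚ else p i j)

  paths : ℕ → List Flowℕ
  paths zero    = edge01 ∷ []
  paths (suc m) = map (extend (suc m)) (paths m) ++ map (reroute (suc m)) (paths m)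

  extend-top : ∀ n p → extend n p n (suc n) ≡ τ
  extend-top n p rewrite ≡ᵇ-refl n = refl

  extend-top-≢ : ∀ n p {i} → i ≢ n → extend n p i (suc n) ≡ 0ℚ
  extend-top-≢ n p i≢n rewrite ≡ᵇ-refl n | ≡ᵇ-false i≢n = refl

  extend-≤ : ∀ n p i {j} → j ℕ.≤ n → extend n p i j ≡ p i j
  extend-≤ n p i j≤n rewrite ≡ᵇ-false (ℕP.<⇒≢ (s≤s j≤n)) = refl

  reroute-top : ∀ n p {i} → i ℕ.< n → reroute n p i (suc n) ≡ p i n
  reroute-top n p i<n rewrite ≡ᵇ-refl n | <ᵇ-true i<n = refl

  reroute-top-≥ : ∀ n p {i} → n ℕ.≤ i → reroute n p i (suc n) ≡ 0ℚ
  reroute-top-≥ n p n≤i rewrite ≡ᵇ-refl n | <ᵇ-false n≤i = refl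

  reroute-n : ∀ n p i → reroute n p i n ≡ 0ℚ
  reroute-n n p i rewrite ≡ᵇ-false (ℕP.<⇒≢ (ℕP.n<1+n n)) | ≡ᵇ-refl n = refl

  reroute-< : ∀ n p i {j} → j ℕ.< n → reroute n p i j ≡ p i j
  reroute-< n p i j<n rewrite ≡ᵇ-false (ℕP.<⇒≢ (ℕP.m<n⇒m<1+n j<n)) | ≡ᵇ-false (ℕP.<⇒≢ j<n) = refl

  record LastEdge (n : ℕ) (p : Flowℕ) : Set where
    field
      from   : ℕ
      from<n : from ℕ.< n
      on     : p from n ≡ τ
      off    : ∀ i → i ℕ.< n → i ≢ from → p i n ≡ 0ℚ

  UniqueOnSupport : ℕ → Flowℕ → Set
  UniqueOnSupport n p = ∀ g → InPolytope τ n g → SupportedOn n g p → EdgewiseEq n g p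

  record IsPathFlow (n : ℕ) (p : Flowℕ) : Set where
    field
      ∈polytope : InPolytope τ n p
      lastEdge  : LastEdge n p
      unique    : UniqueOnSupport n p

  extend-lastEdge : ∀ n p → LastEdge (suc n) (extend n p)
  extend-lastEdge n p = record { from = n ; from<n = ℕP.n<1+n n ; on = extend-top n p ; off = λ i _ i≢n → extend-top-≢ n p i≢n }

  reroute-lastEdge : ∀ {n p} → LastEdge n p → LastEdge (suc n) (reroute n p)
  reroute-lastEdge {n} {p} e = record
    { from   = from
    ; from<n = ℕP.m<n⇒m<1+n from<n
    ; on     = trans (reroute-top n p from<n) on
    ; off    = off′
    }
    where
    open LastEdge e
    off′ : ∀ i → i ℕ.< suc n → i ≢ from → reroute n p i (suc n) ≡ 0ℚ
    off′ i i<1+n i≢from with i ℕ.<? n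
    ... | yes i<n = trans (reroute-top n p i<n) (off i i<n i≢from)
    ... | no  i≮n = reroute-top-≥ n p (ℕP.≮⇒≥ i≮n)

  module _ (0<τ : 0ℚ < τ) where

    0≤τ : 0ℚ ≤ τ
    0≤τ = ℚP.<⇒≤ 0<τ

    τ≢0 : ∀ {x} → x ≡ τ → x ≢ 0ℚ
    τ≢0 x≡τ x≡0 = ℚP.<⇒≢ 0<τ (trans (sym x≡0) x≡τ)

    edge01-∈ : InPolytope τ 1 edge01
    edge01-∈ = record { nonNeg = nonNeg′ ; conserve = conserve′ }
      where
      nonNeg′ : ∀ i j → i ℕ.< j → j ℕ.≤ 1 → 0ℚ ≤ edge01 i j
      nonNeg′ zero    (suc zero) _         _         = 0≤τ
      nonNeg′ (suc i) (suc zero) (s≤s ())  _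
      nonNeg′ _       (suc (suc j)) _      (s≤s ())
      conserve′ : ∀ i → i ℕ.≤ 1 → outflowℕ 1 edge01 i - inflowℕ 1 edge01 i ≡ net τ 1 i
      conserve′ zero          _ = solve 1 (λ t → con 0ℚ :+ con 0ℚ :+ t :- (con 0ℚ :+ con 0ℚ :+ con 0ℚ) := t) refl τ
      conserve′ (suc zero)    _ = solve 1 (λ t → con 0ℚ :+ con 0ℚ :+ con 0ℚ :- (con 0ℚ :+ t :+ con 0ℚ) := :- t) refl τ
      conserve′ (suc (suc i)) (s≤s ())

    edge01-lastEdge : LastEdge 1 edge01
    edge01-lastEdge = record { from = 0 ; from<n = s≤s z≤n ; on = refl ; off = off′ }
      where
      off′ : ∀ i → i ℕ.< 1 → i ≢ 0 → edge01 i 1 ≡ 0ℚ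
      off′ zero    _         0≢0 = ⊥-elim (0≢0 refl)
      off′ (suc i) (s≤s ()) _

    edge01-unique : UniqueOnSupport 1 edge01
    edge01-unique g g∈ _ zero    (suc zero)    _        _        = single-edge≡τ τ g∈
    edge01-unique g g∈ _ (suc i) (suc zero)    (s≤s ()) _
    edge01-unique g g∈ _ _       (suc (suc j)) _        (s≤s ())

    extend-∈ : ∀ {n p} → 1 ℕ.≤ n → InPolytope τ n p → InPolytope τ (suc n) (extend n p)
    extend-∈ {n} {p} 1≤n p∈ = record { nonNeg = by-last-column _ nonNeg-below nonNeg-top ; conserve = conserve′ }
      where
      q = extend n p
      nonNeg-below : ∀ i j → i ℕ.< j → j ℕ.< suc n → 0ℚ ≤ q i j
      nonNeg-below i j i<j j<1+n = subst (0ℚ ≤_) (sym (extend-≤ n p i (ℕP.≤-pred j<1+n))) (nonNeg p∈ i j i<j (ℕP.≤-pred j<1+n))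
      nonNeg-top : ∀ i → i ℕ.< suc n → 0ℚ ≤ q i (suc n)
      nonNeg-top i _ with i ℕ.≟ n
      ... | yes refl = subst (0ℚ ≤_) (sym (extend-top n p)) 0≤τ
      ... | no  i≢n  = subst (0ℚ ≤_) (sym (extend-top-≢ n p i≢n)) ℚP.≤-refl
      outflow-old : ∀ i → outflowℕ n q i ≡ outflowℕ n p i
      outflow-old i = outflowℕ-cong n q p i (λ j _ j≤n → extend-≤ n p i j≤n)
      inflow-old : ∀ i → i ℕ.≤ n → inflowℕ (suc n) q i ≡ inflowℕ n p i
      inflow-old i i≤n = trans (inflowℕ-suc n q (ℕP.m≤n⇒m≤1+n i≤n)) (inflowℕ-cong n q p i (λ k _ → extend-≤ n p k i≤n))
      conserve′ : ∀ i → i ℕ.≤ suc n → outflowℕ (suc n) q i - inflowℕ (suc n) q i ≡ net τ (suc n) i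
      conserve′ i i≤1+n with ℕP.m≤n⇒m<n∨m≡n i≤1+n
      ... | inj₂ refl = begin
        outflowℕ (suc n) q (suc n) - inflowℕ (suc n) q (suc n)
          ≡⟨ cong₂ _-_ (outflowℕ-last (suc n) q)
                       (trans (inflowℕ-self (suc n) q)
                              (cong₂ _+_ (sumBelow-zero n (λ k k<n → extend-top-≢ n p (ℕP.<⇒≢ k<n))) (extend-top n p))) ⟩
        0ℚ - (0ℚ + τ)
          ≡⟨ solve 1 (λ t → con 0ℚ :- (con 0ℚ :+ t) := :- t) refl τ ⟩
        - τ
          ≡⟨ net-last τ (suc n) (s≤s z≤n) ⟨
        net τ (suc n) (suc n) ∎
        where open ≡-Reasoning
      ... | inj₁ (s≤s i≤n) with ℕP.m≤n⇒m<n∨m≡n i≤n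
      ...   | inj₁ i<n = begin
        outflowℕ (suc n) q i - inflowℕ (suc n) q i
          ≡⟨ cong₂ _-_ (cong₂ _+_ (outflow-old i) (trans (when-< _ (ℕP.m<n⇒m<1+n i<n)) (extend-top-≢ n p (ℕP.<⇒≢ i<n))))
                       (inflow-old i i≤n) ⟩
        (outflowℕ n p i + 0ℚ) - inflowℕ n p i
          ≡⟨ cong (_- inflowℕ n p i) (ℚP.+-identityʳ (outflowℕ n p i)) ⟩
        outflowℕ n p i - inflowℕ n p i
          ≡⟨ conserve p∈ i i≤n ⟩
        net τ n i
          ≡⟨ net-suc τ i<n ⟨
        net τ (suc n) i ∎
        where open ≡-Reasoning
      ...   | inj₂ refl = begin
        outflowℕ (suc n) q n - inflowℕ (suc n) q n
          ≡⟨ cong₂ _-_ (trans (outflowℕ-penultimate n q) (extend-top n p)) (inflow-old n ℕP.≤-refl) ⟩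
        τ - inflowℕ n p n
          ≡⟨ cong (_-_ τ) (inflowℕ-sink τ 1≤n p∈) ⟩
        τ - τ
          ≡⟨ ℚP.+-inverseʳ τ ⟩
        0ℚ
          ≡⟨ net-suc-last τ 1≤n ⟨
        net τ (suc n) n ∎
        where open ≡-Reasoning

    outflow-reroute : ∀ n p {i} → i ℕ.< n → outflowℕ (suc n) (reroute n p) i ≡ outflowℕ n p i
    outflow-reroute n p {i} i<n = begin
      outflowℕ (suc n) (reroute n p) i
        ≡⟨ cong₂ _+_ (cong₂ _+_ (sumBelow-cong n (λ j j<n → cong (when (i <ᵇ j)) (reroute-< n p i j<n)))
                                (trans (when-< _ i<n) (reroute-n n p i)))
                     (trans (when-< _ (ℕP.m<n⇒m<1+n i<n)) (reroute-top n p i<n)) ⟩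
      (S + 0ℚ) + p i n
        ≡⟨ cong₂ _+_ (ℚP.+-identityʳ S) (sym (when-< (p i n) i<n)) ⟩
      outflowℕ n p i ∎
      where
      open ≡-Reasoning
      S = sumBelow n (λ j → when (i <ᵇ j) (p i j))

    reroute-∈ : ∀ {n p} → 1 ℕ.≤ n → InPolytope τ n p → InPolytope τ (suc n) (reroute n p)
    reroute-∈ {n} {p} 1≤n p∈ = record { nonNeg = by-last-two-columns _ nonNeg-below nonNeg-n nonNeg-top ; conserve = conserve′ }
      where
      r = reroute n p
      nonNeg-below : ∀ i j → i ℕ.< j → j ℕ.< n → 0ℚ ≤ r i j
      nonNeg-below i j i<j j<n = subst (0ℚ ≤_) (sym (reroute-< n p i j<n)) (nonNeg p∈ i j i<j (ℕP.<⇒≤ j<n))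
      nonNeg-n : ∀ i → i ℕ.< n → 0ℚ ≤ r i n
      nonNeg-n i _ = subst (0ℚ ≤_) (sym (reroute-n n p i)) ℚP.≤-refl
      nonNeg-top : ∀ i → i ℕ.< suc n → 0ℚ ≤ r i (suc n)
      nonNeg-top i _ with i ℕ.<? n
      ... | yes i<n = subst (0ℚ ≤_) (sym (reroute-top n p i<n)) (nonNeg p∈ i n i<n ℕP.≤-refl)
      ... | no  i≮n = subst (0ℚ ≤_) (sym (reroute-top-≥ n p (ℕP.≮⇒≥ i≮n))) ℚP.≤-refl
      conserve′ : ∀ i → i ℕ.≤ suc n → outflowℕ (suc n) r i - inflowℕ (suc n) r i ≡ net τ (suc n) i
      conserve′ i i≤1+n with ℕP.m≤n⇒m<n∨m≡n i≤1+n
      ... | inj₂ refl = begin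
        outflowℕ (suc n) r (suc n) - inflowℕ (suc n) r (suc n)
          ≡⟨ cong₂ _-_ (outflowℕ-last (suc n) r) inflow-top ⟩
        0ℚ - (τ + 0ℚ)
          ≡⟨ solve 1 (λ t → con 0ℚ :- (t :+ con 0ℚ) := :- t) refl τ ⟩
        - τ
          ≡⟨ net-last τ (suc n) (s≤s z≤n) ⟨
        net τ (suc n) (suc n) ∎
        where
        open ≡-Reasoning
        inflow-top : inflowℕ (suc n) r (suc n) ≡ τ + 0ℚ
        inflow-top = begin
          inflowℕ (suc n) r (suc n)                          ≡⟨ inflowℕ-self (suc n) r ⟩
          sumBelow n (λ k → r k (suc n)) + r n (suc n)       ≡⟨ cong₂ _+_ (sumBelow-cong n (λ k k<n → reroute-top n p k<n))
                                                                          (reroute-top-≥ n p ℕP.≤-refl) ⟩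
          sumBelow n (λ k → p k n) + 0ℚ                      ≡⟨ cong (_+ 0ℚ) (inflowℕ-self n p) ⟨
          inflowℕ n p n + 0ℚ                                 ≡⟨ cong (_+ 0ℚ) (inflowℕ-sink τ 1≤n p∈) ⟩
          τ + 0ℚ                                             ∎
      ... | inj₁ (s≤s i≤n) with ℕP.m≤n⇒m<n∨m≡n i≤n
      ...   | inj₁ i<n = begin
        outflowℕ (suc n) r i - inflowℕ (suc n) r i
          ≡⟨ cong₂ _-_ (outflow-reroute n p i<n)
                       (trans (inflowℕ-suc n r i≤1+n) (inflowℕ-cong n r p i (λ k _ → reroute-< n p k i<n))) ⟩
        outflowℕ n p i - inflowℕ n p i
          ≡⟨ conserve p∈ i i≤n ⟩
        net τ n i
          ≡⟨ net-suc τ i<n ⟨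
        net τ (suc n) i ∎
        where open ≡-Reasoning
      ...   | inj₂ refl = begin
        outflowℕ (suc n) r n - inflowℕ (suc n) r n
          ≡⟨ cong₂ _-_ (trans (outflowℕ-penultimate n r) (reroute-top-≥ n p ℕP.≤-refl))
                       (trans (inflowℕ-suc n r i≤1+n) (trans (inflowℕ-self n r) (sumBelow-zero n (λ k _ → reroute-n n p k)))) ⟩
        0ℚ - 0ℚ
          ≡⟨ ℚP.+-inverseʳ 0ℚ ⟩
        0ℚ
          ≡⟨ net-suc-last τ 1≤n ⟨
        net τ (suc n) n ∎
        where open ≡-Reasoning

    -- In both cases the contraction of g is supported on p, hence equals p, and this forces the
    -- last two columns of g.
    extend-unique : ∀ {n p} → 1 ℕ.≤ n → InPolytope τ n p → UniqueOnSupport n p → UniqueOnSupport (suc n) (extend n p)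
    extend-unique {n} {p} 1≤n p∈ p-unique g g∈ g⊆q = by-last-two-columns _ below at-n at-top
      where
      q = extend n p
      g-top-off : ∀ i → i ℕ.< suc n → i ≢ n → g i (suc n) ≡ 0ℚ
      g-top-off i i<1+n i≢n = g⊆q i (suc n) i<1+n ℕP.≤-refl (extend-top-≢ n p i≢n)
      contract-eq : EdgewiseEq n (contract n g) p
      contract-eq = p-unique (contract n g) (contract-∈ τ 1≤n g∈) (by-last-column _ supp-below supp-n)
        where
        supp-below : ∀ i j → i ℕ.< j → j ℕ.< n → p i j ≡ 0ℚ → contract n g i j ≡ 0ℚ
        supp-below i j i<j j<n pij≡0 =
          trans (contract-≢ n g i (ℕP.<⇒≢ j<n)) (g⊆q i j i<j (ℕP.m<n⇒m≤1+n j<n) (trans (extend-≤ n p i (ℕP.<⇒≤ j<n)) pij≡0))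
        supp-n : ∀ i → i ℕ.< n → p i n ≡ 0ℚ → contract n g i n ≡ 0ℚ
        supp-n i i<n pin≡0 = begin
          contract n g i n         ≡⟨ contract-last n g i ⟩
          g i n + g i (suc n)      ≡⟨ cong₂ _+_ (g⊆q i n i<n (ℕP.n≤1+n n) (trans (extend-≤ n p i ℕP.≤-refl) pin≡0))
                                                (g-top-off i (ℕP.m<n⇒m<1+n i<n) (ℕP.<⇒≢ i<n)) ⟩
          0ℚ + 0ℚ                  ≡⟨ ℚP.+-identityˡ 0ℚ ⟩
          0ℚ                       ∎
          where open ≡-Reasoning
      g-n : ∀ i → i ℕ.< n → g i n ≡ p i n
      g-n i i<n = begin
        g i n                    ≡⟨ ℚP.+-identityʳ (g i n) ⟨
        g i n + 0ℚ               ≡⟨ cong (_+_ (g i n)) (g-top-off i (ℕP.m<n⇒m<1+n i<n) (ℕP.<⇒≢ i<n)) ⟨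
        g i n + g i (suc n)      ≡⟨ contract-last n g i ⟨
        contract n g i n         ≡⟨ contract-eq i n i<n ℕP.≤-refl ⟩
        p i n                    ∎
        where open ≡-Reasoning
      below : ∀ i j → i ℕ.< j → j ℕ.< n → g i j ≡ q i j
      below i j i<j j<n =
        trans (sym (contract-≢ n g i (ℕP.<⇒≢ j<n))) (trans (contract-eq i j i<j (ℕP.<⇒≤ j<n)) (sym (extend-≤ n p i (ℕP.<⇒≤ j<n))))
      at-n : ∀ i → i ℕ.< n → g i n ≡ q i n
      at-n i i<n = trans (g-n i i<n) (sym (extend-≤ n p i ℕP.≤-refl))
      at-top : ∀ i → i ℕ.< suc n → g i (suc n) ≡ q i (suc n)
      at-top i i<1+n with i ℕ.≟ n
      ... | no  i≢n  = trans (g-top-off i i<1+n i≢n) (sym (extend-top-≢ n p i≢n))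
      ... | yes refl = begin
        g n (suc n)              ≡⟨ penultimate-balance τ 1≤n g∈ ⟩
        inflowℕ n g n            ≡⟨ inflowℕ-cong n g p n g-n ⟩
        inflowℕ n p n            ≡⟨ inflowℕ-sink τ 1≤n p∈ ⟩
        τ                        ≡⟨ extend-top n p ⟨
        q n (suc n)              ∎
        where open ≡-Reasoning

    reroute-unique : ∀ {n p} → 1 ℕ.≤ n → UniqueOnSupport n p → UniqueOnSupport (suc n) (reroute n p)
    reroute-unique {n} {p} 1≤n p-unique g g∈ g⊆r = by-last-two-columns _ below at-n at-top
      where
      r = reroute n p
      g-n : ∀ i → i ℕ.< n → g i n ≡ 0ℚ
      g-n i i<n = g⊆r i n i<n (ℕP.n≤1+n n) (reroute-n n p i)
      contract-eq : EdgewiseEq n (contract n g) p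
      contract-eq = p-unique (contract n g) (contract-∈ τ 1≤n g∈) (by-last-column _ supp-below supp-n)
        where
        supp-below : ∀ i j → i ℕ.< j → j ℕ.< n → p i j ≡ 0ℚ → contract n g i j ≡ 0ℚ
        supp-below i j i<j j<n pij≡0 =
          trans (contract-≢ n g i (ℕP.<⇒≢ j<n)) (g⊆r i j i<j (ℕP.m<n⇒m≤1+n j<n) (trans (reroute-< n p i j<n) pij≡0))
        supp-n : ∀ i → i ℕ.< n → p i n ≡ 0ℚ → contract n g i n ≡ 0ℚ
        supp-n i i<n pin≡0 = begin
          contract n g i n         ≡⟨ contract-last n g i ⟩
          g i n + g i (suc n)      ≡⟨ cong₂ _+_ (g-n i i<n)
                                                (g⊆r i (suc n) (ℕP.m<n⇒m<1+n i<n) ℕP.≤-refl (trans (reroute-top n p i<n) pin≡0)) ⟩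
          0ℚ + 0ℚ                  ≡⟨ ℚP.+-identityˡ 0ℚ ⟩
          0ℚ                       ∎
          where open ≡-Reasoning
      below : ∀ i j → i ℕ.< j → j ℕ.< n → g i j ≡ r i j
      below i j i<j j<n =
        trans (sym (contract-≢ n g i (ℕP.<⇒≢ j<n))) (trans (contract-eq i j i<j (ℕP.<⇒≤ j<n)) (sym (reroute-< n p i j<n)))
      at-n : ∀ i → i ℕ.< n → g i n ≡ r i n
      at-n i i<n = trans (g-n i i<n) (sym (reroute-n n p i))
      at-top : ∀ i → i ℕ.< suc n → g i (suc n) ≡ r i (suc n)
      at-top i i<1+n with i ℕ.<? n
      ... | no  i≮n = trans (g⊆r i (suc n) i<1+n ℕP.≤-refl r≡0) (sym r≡0)
        where r≡0 = reroute-top-≥ n p (ℕP.≮⇒≥ i≮n)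
      ... | yes i<n = begin
        g i (suc n)              ≡⟨ ℚP.+-identityˡ (g i (suc n)) ⟨
        0ℚ + g i (suc n)         ≡⟨ cong (_+ g i (suc n)) (g-n i i<n) ⟨
        g i n + g i (suc n)      ≡⟨ contract-last n g i ⟨
        contract n g i n         ≡⟨ contract-eq i n i<n ℕP.≤-refl ⟩
        p i n                    ≡⟨ reroute-top n p i<n ⟨
        r i (suc n)              ∎
        where open ≡-Reasoning

    edge01-isPath : IsPathFlow 1 edge01
    edge01-isPath = record { ∈polytope = edge01-∈ ; lastEdge = edge01-lastEdge ; unique = edge01-unique }

    extend-isPath : ∀ {n p} → 1 ℕ.≤ n → IsPathFlow n p → IsPathFlow (suc n) (extend n p)
    extend-isPath {n} {p} 1≤n P = record
      { ∈polytope = extend-∈ 1≤n ∈polytope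
      ; lastEdge  = extend-lastEdge n p
      ; unique    = extend-unique 1≤n ∈polytope unique
      }
      where open IsPathFlow P

    reroute-isPath : ∀ {n p} → 1 ℕ.≤ n → IsPathFlow n p → IsPathFlow (suc n) (reroute n p)
    reroute-isPath 1≤n P = record
      { ∈polytope = reroute-∈ 1≤n ∈polytope
      ; lastEdge  = reroute-lastEdge lastEdge
      ; unique    = reroute-unique 1≤n unique
      }
      where open IsPathFlow P

    paths-isPath : ∀ m → All (IsPathFlow (suc m)) (paths m)
    paths-isPath zero    = edge01-isPath ∷ []
    paths-isPath (suc m) = AllP.++⁺ (AllP.gmap⁺ (extend-isPath (s≤s z≤n)) (paths-isPath m))
                                    (AllP.gmap⁺ (reroute-isPath (s≤s z≤n)) (paths-isPath m))

    extend-injective : ∀ n {p q} → EdgewiseEq (suc n) (extend n p) (extend n q) → EdgewiseEq n p q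
    extend-injective n {p} {q} eq i j i<j j≤n =
      trans (sym (extend-≤ n p i j≤n)) (trans (eq i j i<j (ℕP.m≤n⇒m≤1+n j≤n)) (extend-≤ n q i j≤n))

    reroute-injective : ∀ n {p q} → EdgewiseEq (suc n) (reroute n p) (reroute n q) → EdgewiseEq n p q
    reroute-injective n {p} {q} eq = by-last-column _ below at-n
      where
      below : ∀ i j → i ℕ.< j → j ℕ.< n → p i j ≡ q i j
      below i j i<j j<n = trans (sym (reroute-< n p i j<n)) (trans (eq i j i<j (ℕP.m<n⇒m≤1+n j<n)) (reroute-< n q i j<n))
      at-n : ∀ i → i ℕ.< n → p i n ≡ q i n
      at-n i i<n = trans (sym (reroute-top n p i<n)) (trans (eq i (suc n) (ℕP.m<n⇒m<1+n i<n) ℕP.≤-refl) (reroute-top n q i<n))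

    extend≢reroute : ∀ n p q → ¬ EdgewiseEq (suc n) (extend n p) (reroute n q)
    extend≢reroute n p q eq =
      τ≢0 (trans (sym (eq n (suc n) ℕP.≤-refl ℕP.≤-refl)) (extend-top n p)) (reroute-top-≥ n q ℕP.≤-refl)

    paths-distinct : ∀ m → AllPairs (λ p q → ¬ EdgewiseEq (suc m) p q) (paths m)
    paths-distinct zero    = [] ∷ []
    paths-distinct (suc m) = AllPairsP.++⁺
      (AllPairsP.map⁺ (AllPairs.map (λ p≢q → p≢q ∘ extend-injective n) (paths-distinct m)))
      (AllPairsP.map⁺ (AllPairs.map (λ p≢q → p≢q ∘ reroute-injective n) (paths-distinct m)))
      (AllP.map⁺ (All.universal (λ p → AllP.map⁺ (All.universal (extend≢reroute n p) (paths m))) (paths m)))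
      where n = suc m

    -- The contraction of F carries at least δτ along the last edge i₀ → n of p; in F at least half of
    -- it runs along i₀ → n or along i₀ → n+1, so extend or reroute p accordingly, halving δ.
    module DominationStep {n p F δ} (1≤n : 1 ℕ.≤ n) (F∈ : InPolytope τ (suc n) F) (P : IsPathFlow n p)
                          (0<δ : 0ℚ < δ) (δp≤F : ScaledBelow n δ p (contract n F)) where
      open IsPathFlow P
      open LastEdge lastEdge renaming (from to i₀; from<n to i₀<n)

      δ′ : ℚ
      δ′ = δ * ½

      zero-entry : ∀ {i j x} → x ≡ 0ℚ → i ℕ.< j → j ℕ.≤ suc n → δ′ * x ≤ F i j
      zero-entry {i} {j} refl i<j j≤1+n = subst (_≤ F i j) (sym (ℚP.*-zeroʳ δ′)) (nonNeg F∈ i j i<j j≤1+n)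

      old-edge : ∀ {q : Flowℕ} → (∀ i {j} → j ℕ.< n → q i j ≡ p i j) → ∀ i j → i ℕ.< j → j ℕ.< n → δ′ * q i j ≤ F i j
      old-edge {q} q≡p i j i<j j<n = begin
        δ′ * q i j          ≡⟨ cong (δ′ *_) (q≡p i j<n) ⟩
        δ′ * p i j          ≤⟨ ℚP.*-monoʳ-≤-nonNeg (p i j) {{ℚ.nonNegative 0≤pij}} (p*½≤p (ℚP.<⇒≤ 0<δ)) ⟩
        δ * p i j           ≤⟨ δp≤F i j i<j (ℕP.<⇒≤ j<n) ⟩
        contract n F i j    ≡⟨ contract-≢ n F i (ℕP.<⇒≢ j<n) ⟩
        F i j               ∎
        where
        open ℚP.≤-Reasoning
        0≤pij = nonNeg ∈polytope i j i<j (ℕP.<⇒≤ j<n)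

      last-column : ∀ {c} → δ′ * τ ≤ F i₀ c → n ℕ.≤ c → c ℕ.≤ suc n → ∀ i → i ℕ.< n → δ′ * p i n ≤ F i c
      last-column {c} δ′τ≤F n≤c c≤1+n i i<n with i ℕ.≟ i₀
      ... | yes refl = subst (λ x → δ′ * x ≤ F i c) (sym on) δ′τ≤F
      ... | no  i≢i₀ = zero-entry (off i i<n i≢i₀) (ℕP.<-≤-trans i<n n≤c) c≤1+n

      split : (δ * τ) * ½ ≤ F i₀ n ⊎ (δ * τ) * ½ ≤ F i₀ (suc n)
      split with (δ * τ) * ½ ℚP.≤? F i₀ (suc n)
      ... | yes ≤top = inj₂ ≤top
      ... | no  ≰top = inj₁ (half-of-sum δτ≤ ≰top)
        where
        δτ≤ : δ * τ ≤ F i₀ n + F i₀ (suc n)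
        δτ≤ = subst₂ (λ x y → δ * x ≤ y) on (contract-last n F i₀) (δp≤F i₀ n i₀<n ℕP.≤-refl)

      δ′τ≡ : δ′ * τ ≡ (δ * τ) * ½
      δ′τ≡ = solve 2 (λ d t → d :* con ½ :* t := d :* t :* con ½) refl δ τ

      extend-dominated : (δ * τ) * ½ ≤ F i₀ n → ScaledBelow (suc n) δ′ (extend n p) F
      extend-dominated ≤n = by-last-two-columns _ (old-edge {extend n p} (λ i j<n → extend-≤ n p i (ℕP.<⇒≤ j<n))) at-n at-top
        where
        δ′τ≤ : δ′ * τ ≤ F i₀ n
        δ′τ≤ = subst (_≤ F i₀ n) (sym δ′τ≡) ≤n
        at-n : ∀ i → i ℕ.< n → δ′ * extend n p i n ≤ F i n
        at-n i i<n = subst (λ x → δ′ * x ≤ F i n) (sym (extend-≤ n p i ℕP.≤-refl))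
                       (last-column δ′τ≤ ℕP.≤-refl (ℕP.n≤1+n n) i i<n)
        at-top : ∀ i → i ℕ.< suc n → δ′ * extend n p i (suc n) ≤ F i (suc n)
        at-top i i<1+n with i ℕ.≟ n
        ... | no  i≢n  = zero-entry (extend-top-≢ n p i≢n) i<1+n ℕP.≤-refl
        ... | yes refl = begin
          δ′ * extend n p n (suc n)  ≡⟨ cong (δ′ *_) (extend-top n p) ⟩
          δ′ * τ                     ≤⟨ δ′τ≤ ⟩
          F i₀ n                     ≤⟨ term≤sumBelow n i₀ i₀<n (λ k k<n → nonNeg F∈ k n k<n (ℕP.n≤1+n n)) ⟩
          sumBelow n (λ k → F k n)   ≡⟨ inflowℕ-self n F ⟨
          inflowℕ n F n              ≡⟨ penultimate-balance τ 1≤n F∈ ⟨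
          F n (suc n)                ∎
          where open ℚP.≤-Reasoning

      reroute-dominated : (δ * τ) * ½ ≤ F i₀ (suc n) → ScaledBelow (suc n) δ′ (reroute n p) F
      reroute-dominated ≤top = by-last-two-columns _ (old-edge {reroute n p} (λ i j<n → reroute-< n p i j<n)) at-n at-top
        where
        at-n : ∀ i → i ℕ.< n → δ′ * reroute n p i n ≤ F i n
        at-n i i<n = zero-entry (reroute-n n p i) i<n (ℕP.n≤1+n n)
        at-top : ∀ i → i ℕ.< suc n → δ′ * reroute n p i (suc n) ≤ F i (suc n)
        at-top i i<1+n with i ℕ.<? n
        ... | no  i≮n = zero-entry (reroute-top-≥ n p (ℕP.≮⇒≥ i≮n)) i<1+n ℕP.≤-refl
        ... | yes i<n = subst (λ x → δ′ * x ≤ F i (suc n)) (sym (reroute-top n p i<n))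
                          (last-column (subst (_≤ F i₀ (suc n)) (sym δ′τ≡) ≤top) (ℕP.n≤1+n n) ℕP.≤-refl i i<n)

      extend-or-reroute : ScaledBelow (suc n) δ′ (extend n p) F ⊎ ScaledBelow (suc n) δ′ (reroute n p) F
      extend-or-reroute = Sum.map extend-dominated reroute-dominated split

    dominated-path : ∀ m {F} → InPolytope τ (suc m) F → Any (λ p → IsPathFlow (suc m) p × Dominates (suc m) F p) (paths m)
    dominated-path zero {F} F∈ = here (edge01-isPath , 1ℚ , ℚP.positive⁻¹ 1ℚ , ℚP.≤-refl , edge)
      where
      edge : ScaledBelow 1 1ℚ edge01 F
      edge zero    (suc zero)    _        _        = ℚP.≤-reflexive (trans (ℚP.*-identityˡ τ) (sym (single-edge≡τ τ F∈)))
      edge (suc i) (suc zero)    (s≤s ()) _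
      edge _       (suc (suc j)) _        (s≤s ())
    dominated-path (suc m) {F} F∈ =
      Sum.[ AnyP.++⁺ˡ ∘ AnyP.map⁺ , AnyP.++⁺ʳ _ ∘ AnyP.map⁺ ]′
        (AnyP.Any-⊎⁻ (Any.map step (dominated-path m (contract-∈ τ 1≤n F∈))))
      where
      n = suc m
      1≤n : 1 ℕ.≤ n
      1≤n = s≤s z≤n
      step : ∀ {p} → IsPathFlow n p × Dominates n (contract n F) p →
             IsPathFlow (suc n) (extend n p) × Dominates (suc n) F (extend n p)
               ⊎ IsPathFlow (suc n) (reroute n p) × Dominates (suc n) F (reroute n p)
      step (P , δ , 0<δ , δ≤1 , δp≤F) =
        Sum.map (λ d → extend-isPath 1≤n P , δ * ½ , 0<δ′ , δ′≤1 , d)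
                (λ d → reroute-isPath 1≤n P , δ * ½ , 0<δ′ , δ′≤1 , d)
                (DominationStep.extend-or-reroute 1≤n F∈ P 0<δ δp≤F)
        where
        0<δ′ = *-pos 0<δ (ℚP.positive⁻¹ ½)
        δ′≤1 = ℚP.≤-trans (p*½≤p (ℚP.<⇒≤ 0<δ)) δ≤1

-- The average of the path flows

module _ (τ : ℚ) where

  targetℕ : ℕ → ℕ → ℕ → ℚ
  targetℕ n i k =
    if i <ᵇ k
    then (if i ≡ᵇ 0
          then (if k ≡ᵇ n then τ * half^ (n ∸ 1) else τ * half^ k)
          else (if k ≡ᵇ n then τ * half^ (n ∸ i) else τ * half^ (suc (k ∸ i))))
    else 0ℚ

  targetℕ-< : ∀ n {i j} → i ℕ.< j → j ℕ.< n → targetℕ (suc n) i j ≡ targetℕ n i j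
  targetℕ-< n i<j j<n
    rewrite <ᵇ-true i<j | ≡ᵇ-false (ℕP.<⇒≢ (ℕP.m<n⇒m<1+n j<n)) | ≡ᵇ-false (ℕP.<⇒≢ j<n) = refl

  private
    halve : ∀ m i → (if i ≡ᵇ 0 then τ * half^ (suc m) else τ * half^ (suc (suc m ∸ i)))
                    ≡ (if i ≡ᵇ 0 then τ * half^ m else τ * half^ (suc m ∸ i)) * ½
    halve m i with i ≡ᵇ 0
    ... | true  = solve 2 (λ t h → t :* (con ½ :* h) := t :* h :* con ½) refl τ (half^ m)
    ... | false = solve 2 (λ t h → t :* (con ½ :* h) := t :* h :* con ½) refl τ (half^ (suc m ∸ i))

  targetℕ-penultimate : ∀ m {i} → i ℕ.< suc m → targetℕ (suc (suc m)) i (suc m) ≡ targetℕ (suc m) i (suc m) * ½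
  targetℕ-penultimate m {i} i<1+m rewrite <ᵇ-true i<1+m | ≡ᵇ-false (ℕP.<⇒≢ (ℕP.n<1+n m)) | ≡ᵇ-refl m = halve m i

  targetℕ-last : ∀ m {i} → i ℕ.< suc m → targetℕ (suc (suc m)) i (suc (suc m)) ≡ targetℕ (suc m) i (suc m) * ½
  targetℕ-last m {i} i<1+m
    rewrite <ᵇ-true i<1+m | <ᵇ-true (ℕP.m<n⇒m<1+n i<1+m) | ≡ᵇ-refl m | ℕP.+-∸-assoc 1 (ℕP.<⇒≤ i<1+m) = halve m i

  targetℕ-last-edge : ∀ m → targetℕ (suc (suc m)) (suc m) (suc (suc m)) ≡ τ * ½
  targetℕ-last-edge m rewrite <ᵇ-true (ℕP.n<1+n (suc m)) | ≡ᵇ-refl m | ℕP.m+n∸n≡m 1 (suc m) =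
    cong (τ *_) (ℚP.*-identityʳ ½)

  length-paths : ∀ m → length (paths τ m) ≡ 2 ^ m
  length-paths zero    = refl
  length-paths (suc m) = begin
    length (map (extend τ (suc m)) ps ++ map (reroute τ (suc m)) ps)   ≡⟨ ListP.length-++ (map (extend τ (suc m)) ps) ⟩
    length (map (extend τ (suc m)) ps) ℕ.+ length (map (reroute τ (suc m)) ps)
      ≡⟨ cong₂ ℕ._+_ (ListP.length-map (extend τ (suc m)) ps) (ListP.length-map (reroute τ (suc m)) ps) ⟩
    length ps ℕ.+ length ps                                            ≡⟨ cong (λ k → k ℕ.+ k) (length-paths m) ⟩
    2 ^ m ℕ.+ 2 ^ m                                                    ≡⟨ cong (2 ^ m ℕ.+_) (ℕP.+-identityʳ (2 ^ m)) ⟨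
    2 ^ suc m                                                          ∎
    where
    open ≡-Reasoning
    ps = paths τ m

  sum-paths : ∀ m i j → i ℕ.< j → j ℕ.≤ suc m →
              Σℚ (map (λ p → p i j) (paths τ m)) ≡ fromℕ (2 ^ m) * targetℕ (suc m) i j
  sum-paths zero    zero    (suc zero)    _        _        = solve 1 (λ t → t :+ con 0ℚ := con 1ℚ :* (t :* con 1ℚ)) refl τ
  sum-paths zero    (suc i) (suc zero)    (s≤s ()) _
  sum-paths zero    _       (suc (suc j)) _        (s≤s ())
  sum-paths (suc m) = by-last-two-columns _ below at-n at-top
    where
    open ≡-Reasoning
    n = suc m
    ps = paths τ m
    L = fromℕ (2 ^ m)
    Σ-split : ∀ i j → Σℚ (map (λ p → p i j) (paths τ n))
                      ≡ Σℚ (map (λ p → extend τ n p i j) ps) + Σℚ (map (λ p → reroute τ n p i j) ps)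
    Σ-split i j = Σℚ-map-++-map (λ p → p i j) (extend τ n) (reroute τ n) ps
    double-half : ∀ x → L * x ≡ (L + L) * (x * ½)
    double-half x = solve 2 (λ L x → L :* x := (L :+ L) :* (x :* con ½)) refl L x
    below : ∀ i j → i ℕ.< j → j ℕ.< n → Σℚ (map (λ p → p i j) (paths τ n)) ≡ fromℕ (2 ^ n) * targetℕ (suc n) i j
    below i j i<j j<n = begin
      Σℚ (map (λ p → p i j) (paths τ n))
        ≡⟨ Σ-split i j ⟩
      Σℚ (map (λ p → extend τ n p i j) ps) + Σℚ (map (λ p → reroute τ n p i j) ps)
        ≡⟨ cong₂ _+_ (Σℚ-map-cong ps (λ p → extend-≤ τ n p i (ℕP.<⇒≤ j<n))) (Σℚ-map-cong ps (λ p → reroute-< τ n p i j<n)) ⟩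
      Σℚ (map (λ p → p i j) ps) + Σℚ (map (λ p → p i j) ps)
        ≡⟨ cong (λ s → s + s) (sum-paths m i j i<j (ℕP.<⇒≤ j<n)) ⟩
      L * targetℕ n i j + L * targetℕ n i j
        ≡⟨ ℚP.*-distribʳ-+ (targetℕ n i j) L L ⟨
      (L + L) * targetℕ n i j
        ≡⟨ cong₂ _*_ (fromℕ-double (2 ^ m)) (targetℕ-< n i<j j<n) ⟨
      fromℕ (2 ^ n) * targetℕ (suc n) i j ∎
    at-n : ∀ i → i ℕ.< n → Σℚ (map (λ p → p i n) (paths τ n)) ≡ fromℕ (2 ^ n) * targetℕ (suc n) i n
    at-n i i<n = begin
      Σℚ (map (λ p → p i n) (paths τ n))
        ≡⟨ Σ-split i n ⟩
      Σℚ (map (λ p → extend τ n p i n) ps) + Σℚ (map (λ p → reroute τ n p i n) ps)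
        ≡⟨ cong₂ _+_ (Σℚ-map-cong ps (λ p → extend-≤ τ n p i ℕP.≤-refl)) (Σℚ-map-zero ps (λ p → reroute-n τ n p i)) ⟩
      Σℚ (map (λ p → p i n) ps) + 0ℚ
        ≡⟨ trans (ℚP.+-identityʳ _) (sum-paths m i n i<n ℕP.≤-refl) ⟩
      L * targetℕ n i n
        ≡⟨ double-half (targetℕ n i n) ⟩
      (L + L) * (targetℕ n i n * ½)
        ≡⟨ cong₂ _*_ (fromℕ-double (2 ^ m)) (targetℕ-penultimate m i<n) ⟨
      fromℕ (2 ^ n) * targetℕ (suc n) i n ∎
    at-top : ∀ i → i ℕ.< suc n → Σℚ (map (λ p → p i (suc n)) (paths τ n)) ≡ fromℕ (2 ^ n) * targetℕ (suc n) i (suc n)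
    at-top i i<1+n with i ℕ.≟ n
    ... | yes refl = begin
      Σℚ (map (λ p → p n (suc n)) (paths τ n))
        ≡⟨ Σ-split n (suc n) ⟩
      Σℚ (map (λ p → extend τ n p n (suc n)) ps) + Σℚ (map (λ p → reroute τ n p n (suc n)) ps)
        ≡⟨ cong₂ _+_ (trans (Σℚ-map-cong ps (λ p → extend-top τ n p)) (Σℚ-map-const ps τ))
                     (Σℚ-map-zero ps (λ p → reroute-top-≥ τ n p ℕP.≤-refl)) ⟩
      fromℕ (length ps) * τ + 0ℚ
        ≡⟨ trans (ℚP.+-identityʳ _) (cong (λ k → fromℕ k * τ) (length-paths m)) ⟩
      L * τ
        ≡⟨ double-half τ ⟩
      (L + L) * (τ * ½)
        ≡⟨ cong₂ _*_ (fromℕ-double (2 ^ m)) (targetℕ-last-edge m) ⟨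
      fromℕ (2 ^ n) * targetℕ (suc n) n (suc n) ∎
    ... | no i≢n = begin
      Σℚ (map (λ p → p i (suc n)) (paths τ n))
        ≡⟨ Σ-split i (suc n) ⟩
      Σℚ (map (λ p → extend τ n p i (suc n)) ps) + Σℚ (map (λ p → reroute τ n p i (suc n)) ps)
        ≡⟨ cong₂ _+_ (Σℚ-map-zero ps (λ p → extend-top-≢ τ n p i≢n)) (Σℚ-map-cong ps (λ p → reroute-top τ n p i<n)) ⟩
      0ℚ + Σℚ (map (λ p → p i n) ps)
        ≡⟨ trans (ℚP.+-identityˡ _) (sum-paths m i n i<n ℕP.≤-refl) ⟩
      L * targetℕ n i n
        ≡⟨ double-half (targetℕ n i n) ⟩
      (L + L) * (targetℕ n i n * ½)
        ≡⟨ cong₂ _*_ (fromℕ-double (2 ^ m)) (targetℕ-last m i<n) ⟨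
      fromℕ (2 ^ n) * targetℕ (suc n) i (suc n) ∎
      where i<n = ℕP.≤∧≢⇒< (ℕP.≤-pred i<1+n) i≢n

  net-minus-target : ∀ m I → 1 ℕ.≤ I → I ℕ.≤ m → sumBelow I (λ r → net τ (suc m) r - targetℕ (suc m) r I) ≡ τ * ½
  net-minus-target m (suc a) _ 1+a≤m = begin
    sumBelow (suc a) (λ r → net τ (suc m) r - targetℕ (suc m) r (suc a))
      ≡⟨ sumBelow-suc a (λ r → net τ (suc m) r - targetℕ (suc m) r (suc a)) ⟩
    (τ - targetℕ (suc m) 0 (suc a)) + sumBelow a (λ r → net τ (suc m) (suc r) - targetℕ (suc m) (suc r) (suc a))
      ≡⟨ cong₂ _+_ (cong (_-_ τ) direct) (trans (sumBelow-cong a via) (sumBelow-* a (- τ) (λ r → half^ (suc (a ∸ r))))) ⟩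
    (τ - τ * half^ (suc a)) + (- τ) * W
      ≡⟨ solve 3 (λ t h W → (t :- t :* h) :+ (:- t) :* W := t :- t :* (W :+ h)) refl τ (half^ (suc a)) W ⟩
    τ - τ * (W + half^ (suc a))
      ≡⟨ cong (λ x → τ - τ * x) (sumBelow-half^ a) ⟩
    τ - τ * ½
      ≡⟨ solve 1 (λ t → t :- t :* con ½ := t :* con ½) refl τ ⟩
    τ * ½ ∎
    where
    open ≡-Reasoning
    W = sumBelow a (λ r → half^ (suc (a ∸ r)))
    direct : targetℕ (suc m) 0 (suc a) ≡ τ * half^ (suc a)
    direct rewrite ≡ᵇ-false (ℕP.<⇒≢ (s≤s 1+a≤m)) = refl
    via : ∀ r → r ℕ.< a → net τ (suc m) (suc r) - targetℕ (suc m) (suc r) (suc a) ≡ (- τ) * half^ (suc (a ∸ r))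
    via r r<a
      rewrite ≡ᵇ-false (ℕP.<⇒≢ (ℕP.<-trans (s≤s r<a) (s≤s 1+a≤m))) | <ᵇ-true (s≤s r<a) | ≡ᵇ-false (ℕP.<⇒≢ (s≤s 1+a≤m)) =
      solve 2 (λ t h → con 0ℚ :- t :* h := (:- t) :* h) refl τ (half^ (suc (a ∸ r)))

restrict : ∀ n → Flowℕ → Flow n
restrict n F i j = F (toℕ i) (toℕ j)

clamp : ∀ n → ℕ → Fin (suc n)
clamp n i = fromℕ< (s≤s (ℕP.m⊓n≤n i n))

toℕ-clamp : ∀ {n i} → i ℕ.≤ n → toℕ (clamp n i) ≡ i
toℕ-clamp {n} {i} i≤n = trans (FinP.toℕ-fromℕ< (s≤s (ℕP.m⊓n≤n i n))) (ℕP.m≤n⇒m⊓n≡m i≤n)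

clamp-toℕ : ∀ {n} (x : Fin (suc n)) → clamp n (toℕ x) ≡ x
clamp-toℕ x = FinP.toℕ-injective (toℕ-clamp (FinP.toℕ≤pred[n] x))

unrestrict : ∀ n → Flow n → Flowℕ
unrestrict n f i j = f (clamp n i) (clamp n j)

restrict-unrestrict : ∀ {n} (f : Flow n) x y → restrict n (unrestrict n f) x y ≡ f x y
restrict-unrestrict f x y = cong₂ f (clamp-toℕ x) (clamp-toℕ y)

by-Fin-edges : ∀ {n} (P : ℕ → ℕ → Set) → (∀ (x y : Fin (suc n)) → toℕ x ℕ.< toℕ y → P (toℕ x) (toℕ y)) →
               ∀ i j → i ℕ.< j → j ℕ.≤ n → P i j
by-Fin-edges {n} P P-edges i j i<j j≤n =
  subst₂ P toℕ-clamp-i (toℕ-clamp j≤n) (P-edges (clamp n i) (clamp n j) (subst₂ ℕ._<_ (sym toℕ-clamp-i) (sym (toℕ-clamp j≤n)) i<j))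
  where toℕ-clamp-i = toℕ-clamp (ℕP.≤-trans (ℕP.<⇒≤ i<j) j≤n)

restrict-≋⇒EdgewiseEq : ∀ {n F G} → restrict n F ≋ restrict n G → EdgewiseEq n F G
restrict-≋⇒EdgewiseEq {F = F} {G} = by-Fin-edges (λ a b → F a b ≡ G a b)

unrestrict-supported : ∀ {n p} {g : Flow n} → (∀ x y → toℕ x ℕ.< toℕ y → p (toℕ x) (toℕ y) ≡ 0ℚ → g x y ≡ 0ℚ) →
                       SupportedOn n (unrestrict n g) p
unrestrict-supported {n} {p} {g} g⊆p = by-Fin-edges (λ a b → p a b ≡ 0ℚ → unrestrict n g a b ≡ 0ℚ)
  (λ x y x<y p≡0 → trans (restrict-unrestrict g x y) (g⊆p x y x<y p≡0))

outflow-restrict : ∀ n F x → outflow (restrict n F) x ≡ outflowℕ n F (toℕ x)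
outflow-restrict n F x = Σℚ-allFin (suc n) (λ j → when (toℕ x <ᵇ j) (F (toℕ x) j))

inflow-restrict : ∀ n F x → inflow (restrict n F) x ≡ inflowℕ n F (toℕ x)
inflow-restrict n F x = Σℚ-allFin (suc n) (λ k → when (k <ᵇ toℕ x) (F k (toℕ x)))

outflow-≋ : ∀ {n} {f g : Flow n} → f ≋ g → ∀ x → outflow f x ≡ outflow g x
outflow-≋ f≋g x = Σℚ-map-cong (allFin _) (λ j → when-<-cong (f≋g x j))

inflow-≋ : ∀ {n} {f g : Flow n} → f ≋ g → ∀ x → inflow f x ≡ inflow g x
inflow-≋ f≋g x = Σℚ-map-cong (allFin _) (λ k → when-<-cong (λ k<x → f≋g k x k<x))

InFlowPolytope-≋ : ∀ {n} {N} {f g : Flow n} → f ≋ g → InFlowPolytope N g → InFlowPolytope N f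
InFlowPolytope-≋ f≋g (0≤g , g-conserve) =
  (λ x y x<y → subst (0ℚ ≤_) (sym (f≋g x y x<y)) (0≤g x y x<y)) ,
  (λ x → trans (cong₂ _-_ (outflow-≋ f≋g x) (inflow-≋ f≋g x)) (g-conserve x))

netN/1≡net : ∀ n t (x : Fin (suc n)) → netN n t x / 1 ≡ net (fromℕ t) n (toℕ x)
netN/1≡net n t x with toℕ x ≡ᵇ 0 | toℕ x ≡ᵇ n
... | true  | _     = refl
... | false | true  = neg/1≡-fromℕ t
... | false | false = refl

average-≡ : ∀ {n} (vs : List (Flow n)) {x y X} → 1 ℕ.≤ length vs →
            sumFlows vs x y ≡ fromℕ (length vs) * X → average vs x y ≡ X
average-≡ (v ∷ vs) {x} {y} {X} _ Σ≡ = begin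
  (+ 1 / suc (length vs)) * sumFlows (v ∷ vs) x y            ≡⟨ cong (_*_ (+ 1 / suc (length vs))) Σ≡ ⟩
  (+ 1 / suc (length vs)) * (fromℕ (suc (length vs)) * X)    ≡⟨ ℚP.*-assoc (+ 1 / suc (length vs)) _ X ⟨
  ((+ 1 / suc (length vs)) * fromℕ (suc (length vs))) * X    ≡⟨ cong (_* X) (1/suc*suc≡1 (length vs)) ⟩
  1ℚ * X                                                     ≡⟨ ℚP.*-identityˡ X ⟩
  X                                                          ∎
  where open ≡-Reasoning

module _ (t : ℕ) where
  open InPolytope

  private
    τ : ℚ
    τ = fromℕ t

  restrict-∈ : ∀ {n F} → InPolytope τ n F → InFlowPolytope (netN n t) (restrict n F)
  restrict-∈ {n} {F} F∈ =
    (λ x y x<y → nonNeg F∈ (toℕ x) (toℕ y) x<y (FinP.toℕ≤pred[n] y)) ,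
    (λ x → begin
      outflow (restrict n F) x - inflow (restrict n F) x   ≡⟨ cong₂ _-_ (outflow-restrict n F x) (inflow-restrict n F x) ⟩
      outflowℕ n F (toℕ x) - inflowℕ n F (toℕ x)           ≡⟨ conserve F∈ (toℕ x) (FinP.toℕ≤pred[n] x) ⟩
      net τ n (toℕ x)                                      ≡⟨ netN/1≡net n t x ⟨
      netN n t x / 1                                       ∎)
    where open ≡-Reasoning

  unrestrict-∈ : ∀ {n f} → InFlowPolytope (netN n t) f → InPolytope τ n (unrestrict n f)
  unrestrict-∈ {n} {f} f∈ = record
    { nonNeg   = by-Fin-edges (λ a b → 0ℚ ≤ F a b) (λ x y x<y → subst (0ℚ ≤_) (sym (restrict-unrestrict f x y)) (proj₁ f∈ x y x<y))
    ; conserve = λ i i≤n → subst (λ k → outflowℕ n F k - inflowℕ n F k ≡ net τ n k) (toℕ-clamp i≤n) (conserve′ (clamp n i))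
    }
    where
    F = unrestrict n f
    f≋ : restrict n F ≋ f
    f≋ x y _ = restrict-unrestrict f x y
    conserve′ : ∀ x → outflowℕ n F (toℕ x) - inflowℕ n F (toℕ x) ≡ net τ n (toℕ x)
    conserve′ x = begin
      outflowℕ n F (toℕ x) - inflowℕ n F (toℕ x)   ≡⟨ cong₂ _-_ (outflow-restrict n F x) (inflow-restrict n F x) ⟨
      outflow (restrict n F) x - inflow (restrict n F) x   ≡⟨ proj₂ (InFlowPolytope-≋ {N = netN n t} f≋ f∈) x ⟩
      netN n t x / 1                               ≡⟨ netN/1≡net n t x ⟩
      net τ n (toℕ x)                              ∎
      where open ≡-Reasoning

  module _ (0<τ : 0ℚ < τ) where

    pathFlow-isVertex : ∀ {n p f} → IsPathFlow τ n p → f ≋ restrict n p → IsVertex (netN n t) f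
    pathFlow-isVertex {n} {p} {f} P f≋p = InFlowPolytope-≋ {N = netN n t} f≋p (restrict-∈ ∈polytope) , extreme
      where
      open IsPathFlow P
      equal-if-supported : ∀ g → InFlowPolytope (netN n t) g →
                           (∀ x y → toℕ x ℕ.< toℕ y → p (toℕ x) (toℕ y) ≡ 0ℚ → g x y ≡ 0ℚ) → f ≋ g
      equal-if-supported g g∈ g⊆p x y x<y = begin
        f x y                           ≡⟨ f≋p x y x<y ⟩
        p (toℕ x) (toℕ y)               ≡⟨ unique (unrestrict n g) (unrestrict-∈ g∈) (unrestrict-supported g⊆p)
                                                  (toℕ x) (toℕ y) x<y (FinP.toℕ≤pred[n] y) ⟨
        unrestrict n g (toℕ x) (toℕ y)  ≡⟨ restrict-unrestrict g x y ⟩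
        g x y                           ∎
        where open ≡-Reasoning
      extreme : ∀ g h l → InFlowPolytope (netN n t) g → InFlowPolytope (netN n t) h →
                0ℚ < l → l < 1ℚ → f ≋ convComb l g h → f ≋ g × f ≋ h
      extreme g h l g∈ h∈ 0<l l<1 f≋gh =
        equal-if-supported g g∈ (λ x y x<y p≡0 →
          pos-combination≡0⇒≡0 0<l 0<1-l (proj₁ g∈ x y x<y) (proj₁ h∈ x y x<y) (gh≡0 x y x<y p≡0)) ,
        equal-if-supported h h∈ (λ x y x<y p≡0 →
          pos-combination≡0⇒≡0 0<1-l 0<l (proj₁ h∈ x y x<y) (proj₁ g∈ x y x<y)
            (trans (ℚP.+-comm ((1ℚ - l) * h x y) (l * g x y)) (gh≡0 x y x<y p≡0)))
        where
        0<1-l = p<q⇒0<q-p l<1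
        gh≡0 : ∀ x y → toℕ x ℕ.< toℕ y → p (toℕ x) (toℕ y) ≡ 0ℚ → l * g x y + (1ℚ - l) * h x y ≡ 0ℚ
        gh≡0 x y x<y p≡0 = trans (sym (f≋gh x y x<y)) (trans (f≋p x y x<y) p≡0)

    -- f is the midpoint of f ± δ(p - f), which both lie in the polytope because δp ≤ f.
    vertex-isPathFlow : ∀ {n p f} → IsVertex (netN n t) f → IsPathFlow τ n p → Dominates n (unrestrict n f) p →
                        f ≋ restrict n p
    vertex-isPathFlow {n} {p} {f} (f∈ , extreme) P (δ , 0<δ , δ≤1 , δp≤F) x y x<y = begin
      f x y          ≡⟨ restrict-unrestrict f x y ⟨
      F i j          ≡⟨ x∙y⁻¹≈ε⇒x≈y (p i j) (F i j) (pos*p≡0⇒p≡0 0<δ δ[p-F]≡0) ⟨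
      p i j          ∎
      where
      open ≡-Reasoning
      open IsPathFlow P
      i = toℕ x
      j = toℕ y
      F = unrestrict n f
      F∈ = unrestrict-∈ f∈
      G H : Flowℕ
      G = linComb (1ℚ - δ) F δ p
      H = linComb (1ℚ + δ) F (- δ) p
      G∈,H∈ = perturbations-∈ τ F∈ ∈polytope (ℚP.<⇒≤ 0<δ) δ≤1 δp≤F
      f≋GH : f ≋ convComb ½ (restrict n G) (restrict n H)
      f≋GH x y _ = trans (sym (restrict-unrestrict f x y))
        (solve 3 (λ F d p → F := con ½ :* ((con 1ℚ :- d) :* F :+ d :* p) :+ (con 1ℚ :- con ½) :* ((con 1ℚ :+ d) :* F :+ (:- d) :* p))
               refl (F (toℕ x) (toℕ y)) δ (p (toℕ x) (toℕ y)))
      f≋G : f ≋ restrict n G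
      f≋G = proj₁ (extreme (restrict n G) (restrict n H) ½ (restrict-∈ (proj₁ G∈,H∈)) (restrict-∈ (proj₂ G∈,H∈))
                           (ℚP.positive⁻¹ ½) ½<1 f≋GH)
        where ½<1 = ℚ.*<* (ℤ.+<+ (s≤s (s≤s z≤n)))
      δ[p-F]≡0 : δ * (p i j - F i j) ≡ 0ℚ
      δ[p-F]≡0 = begin
        δ * (p i j - F i j)
          ≡⟨ solve 3 (λ d F p → d :* (p :- F) := ((con 1ℚ :- d) :* F :+ d :* p) :- F) refl δ (F i j) (p i j) ⟩
        G i j - F i j
          ≡⟨ cong (_- F i j) (trans (sym (f≋G x y x<y)) (sym (restrict-unrestrict f x y))) ⟩
        F i j - F i j
          ≡⟨ ℚP.+-inverseʳ (F i j) ⟩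
        0ℚ ∎

    vertices : ∀ m f → IsVertex (netN (suc m) t) f ⇔ Any (f ≋_) (map (restrict (suc m)) (paths τ m))
    vertices m f = mk⇔ to from
      where
      to : IsVertex (netN (suc m) t) f → Any (f ≋_) (map (restrict (suc m)) (paths τ m))
      to f-vertex = AnyP.map⁺ (Any.map (λ (P , D) → vertex-isPathFlow f-vertex P D)
                                       (dominated-path τ 0<τ m (unrestrict-∈ (proj₁ f-vertex))))
      from : Any (f ≋_) (map (restrict (suc m)) (paths τ m)) → IsVertex (netN (suc m) t) f
      from f∈paths = let P , f≋p = All.lookupAny (paths-isPath τ 0<τ m) (AnyP.map⁻ f∈paths) in pathFlow-isVertex P f≋p

    restricted-paths-distinct : ∀ m → AllPairs (λ u v → ¬ (u ≋ v)) (map (restrict (suc m)) (paths τ m))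
    restricted-paths-distinct m =
      AllPairsP.map⁺ (AllPairs.map (λ p≢q → p≢q ∘ restrict-≋⇒EdgewiseEq) (paths-distinct τ 0<τ m))

  average-paths : ∀ m → average (map (restrict (suc m)) (paths τ m)) ≋ targetFlow (suc m) t
  average-paths m x y x<y = average-≡ vs (subst (1 ℕ.≤_) (sym length-vs) (ℕP.m^n>0 2 m)) (begin
    sumFlows vs x y                                        ≡⟨ cong Σℚ (ListP.map-∘ (paths τ m)) ⟨
    Σℚ (map (λ p → p (toℕ x) (toℕ y)) (paths τ m))         ≡⟨ sum-paths τ m (toℕ x) (toℕ y) x<y (FinP.toℕ≤pred[n] y) ⟩
    fromℕ (2 ^ m) * targetℕ τ (suc m) (toℕ x) (toℕ y)      ≡⟨ cong (λ k → fromℕ k * targetFlow (suc m) t x y) length-vs ⟨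
    fromℕ (length vs) * targetFlow (suc m) t x y           ∎)
    where
    open ≡-Reasoning
    vs = map (restrict (suc m)) (paths τ m)
    length-vs : length vs ≡ 2 ^ m
    length-vs = trans (ListP.length-map (restrict (suc m)) (paths τ m)) (length-paths τ m)

  net-minus-target-cut : ∀ m (i : Fin (suc (suc m))) → 1 ℕ.≤ toℕ i → toℕ i ℕ.≤ m →
    Σℚ (map (λ r → if toℕ r ℕ.<ᵇ toℕ i then (netN (suc m) t r / 1) - targetFlow (suc m) t r i else (+ 0) / 1)
            (allFin (suc (suc m))))
      ≡ (+ t) / 2
  net-minus-target-cut m i 1≤I I≤m = begin
    Σℚ (map (λ r → when (toℕ r <ᵇ I) ((netN (suc m) t r / 1) - targetFlow (suc m) t r i)) (allFin (suc (suc m))))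
      ≡⟨ Σℚ-map-cong (allFin _) (λ r → cong (λ v → when (toℕ r <ᵇ I) (v - targetFlow (suc m) t r i)) (netN/1≡net (suc m) t r)) ⟩
    Σℚ (map (G ∘ toℕ) (allFin (suc (suc m))))
      ≡⟨ Σℚ-allFin (suc (suc m)) G ⟩
    sumBelow (suc (suc m)) G
      ≡⟨ sumBelow-trunc (suc (suc m)) (ℕP.m≤n⇒m≤1+n (ℕP.m≤n⇒m≤1+n I≤m)) (λ r I≤r _ → when-≥ _ I≤r) ⟩
    sumBelow I G
      ≡⟨ sumBelow-cong I (λ r r<I → when-< _ r<I) ⟩
    sumBelow I (λ r → net τ (suc m) r - targetℕ τ (suc m) r I)
      ≡⟨ net-minus-target τ m I 1≤I I≤m ⟩
    τ * ½
      ≡⟨ fromℕ*½ t ⟩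
    (+ t) / 2 ∎
    where
    open ≡-Reasoning
    I = toℕ i
    G : ℕ → ℚ
    G r = when (r <ᵇ I) (net τ (suc m) r - targetℕ τ (suc m) r I)

proposition4p2 : ∀ (n t : ℕ) → 2 ℕ.≤ n → 1 ℕ.≤ t →
    (∃[ vs ] (AllPairs (λ u v → ¬ (u ≋ v)) vs
      × (∀ (f : Flow n) → (IsVertex (netN n t) f ⇔ Any (λ v → f ≋ v) vs))
      × average vs ≋ targetFlow n t))
    × (∀ (i : Fin (suc n)) → 1 ℕ.≤ toℕ i → toℕ i ℕ.≤ n ℕ.∸ 1 →
        Σℚ (map (λ r → if toℕ r ℕ.<ᵇ toℕ i then (netN n t r / 1) - targetFlow n t r i else (+ 0) / 1)
                (allFin (suc n)))
        ≡ (+ t) / 2)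
proposition4p2 (suc (suc k)) (suc t′) (s≤s (s≤s z≤n)) (s≤s z≤n) =
  ( map (restrict (suc (suc k))) (paths τ (suc k))
  , restricted-paths-distinct t 0<τ (suc k)
  , vertices t 0<τ (suc k)
  , average-paths t (suc k) )
  , net-minus-target-cut t (suc k)
  where
  t = suc t′
  τ = fromℕ t
  0<τ = fromℕ-pos t′
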